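{- Let $1\le k<n$. The map $F_k:\mathbb{Y}_{OG(k,2n)}\to\tilde P(n-k,n)$, $F_k(\lambda)=((\lambda^{(1)}_i+\lambda^{(2)}_i)_{1\le i\le k};t)$ with $t=1$ if $\lambda$ is assigned $\uparrow$, $t=2$ if $\lambda$ is assigned $\downarrow$, and $t=0$ otherwise, is a bijection. Moreover $F_k(\lambda(w))=\tilde\gamma(w)$ for every $w\in W^{OG(k,2n)}$, i.e. the Schubert variety indexed by $\lambda(w)$ equals that indexed by $F_k(\lambda(w))$.
   Context: Type $D_n$ positive roots: $e_a-e_b$, $e_a+e_b$ ($1\le a<b\le n$); simple roots $\beta_i=e_i-e_{i+1}$ ($i<n$), $\beta_n=e_{n-1}+e_n$; $\alpha\preceq\alpha'$ iff $\alpha'-\alpha$ is a nonnegative combination of simple roots. $\Lambda_k$ consists of $e_a\pm e_c$ with $a\le k<c$ (base region) and $e_a+e_b$ with $a<b\le k$ (top region). For $1\le i\le k$ the $i$-th double-tailed diamond is $D_i=\{e_{k+1-i}\pm e_c: c>k\}$. For $S\subseteq\Lambda_k$, $S^{(1)}_i=|S\cap D_i|$ and $S^{(2)}_i=|\{a<k+1-i: e_a+e_{k+1-i}\in S\}|$. If $S^{(1)}_i=n-k$ for some $i$, $S$ is assigned $\uparrow$ if $e_{k+1-i}-e_n\in S$ and $\downarrow$ if $e_{k+1-i}+e_n\in S$. $W^{OG(k,2n)}$: signed permutations with an even number of barred (negative) entries of the form $w=(y_1,\dots,y_{k-r},\overline{z_r},\dots,\overline{z_1},v_1,\dots,v_{n-k-1},\widehat{v_{n-k}})$,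 $0\le r\le k$, $\{y\}\cup\{z\}\cup\{v\}=\{1,\dots,n\}$, $y_1<\dots<y_{k-r}$, $z_r>\dots>z_1$, $v_1<\dots<v_{n-k}$, where $\widehat{v_{n-k}}$ is $v_{n-k}$ or $\overline{v_{n-k}}$ as the parity of $r$ requires; $w$ is of type I if the last entry is unbarred, type II otherwise. $w(e_a)=e_m$ if the $a$-th entry is $m$, $-e_m$ if it is $\overline m$; $\lambda(w)=\{\alpha>0:w(\alpha)<0\}$, $\mathbb{Y}_{OG(k,2n)}=\{\lambda(w)\}$; these index the Schubert varieties of $OG(k,2n)$. $\tilde P(n-k,n)$ is the set of pairs $(\gamma;t)$ with $\gamma$ an $(n-k)$-strict partition ($\gamma_i>\gamma_{i+1}$ whenever $\gamma_i>n-k$) with at most $k$ parts each $\le 2n-1-k$, and $t=0$ if no part equals $n-k$, $t\in\{1,2\}$ otherwise. In the Buch–Kresch–Tamvakis indexing the Schubert variety of $w$ is indexed by $\tilde\gamma(w)=(\gamma;t)$ with $\gamma_i=(n-k)+(n-z_i)$ for $i\le r$, $\gamma_i=|\{l:y_{k+1-i}>v_l\}|$ for $i>r$, and $t=0$ if $\gamma$ has no part $n-k$, otherwise $t=1$ if $w$ is type I and $t=2$ if type II. -}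

module Defs where

open import Data.Bool using (Bool; true; false; if_then_else_; _∧_; _∨_; not)
open import Data.Nat using (ℕ; zero; suc; _+_; _∸_; _≤_; _<_; _<ᵇ_; _≡ᵇ_)
open import Data.List using (List; []; _∷_; _++_; map; length; upTo; reverse)
open import Data.Nat.ListAction using (sum)
open import Data.Bool.ListAction using (any)
open import Data.List.Membership.Propositional using (_∈_)
open import Data.List.Relation.Unary.All using (All)
open import Data.List.Relation.Unary.Linked using (Linked)
open import Data.List.Relation.Binary.Permutation.Propositional using (_↭_)
open import Data.Product using (_×_; _,_; proj₁; proj₂)
open import Data.Sum using (_⊎_)
open import Relation.Binary.PropositionalEquality using (_≡_)
open import Relation.Nullary using (¬_)

b2n : Bool → ℕ
b2n true  = 1
b2n false = 0

count : List Bool → ℕ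
count bs = sum (map b2n bs)

-- [a .. b] (empty if b < a)
between : ℕ → ℕ → List ℕ
between a b = map (a +_) (upTo (suc b ∸ a))

odd : ℕ → Bool
odd zero    = false
odd (suc m) = not (odd m)

-- minus a b = e_a - e_b ,  plus a b = e_a + e_b
data Root : Set where
  minus plus : ℕ → ℕ → Root

isPosRoot : ℕ → Root → Bool
isPosRoot n (minus a b) = (0 <ᵇ a) ∧ (a <ᵇ b) ∧ (b <ᵇ suc n)
isPosRoot n (plus a b)  = (0 <ᵇ a) ∧ (a <ᵇ b) ∧ (b <ᵇ suc n)

RootSet : Set
RootSet = Root → Bool

_≈ₛ_ : RootSet → RootSet → Set
S ≈ₛ T = ∀ α → S α ≡ T α

-- Signed permutations in one-line notation.
-- An entry is (barred? , m): (false , m) is m, (true , m) is \bar m.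

Entry : Set
Entry = Bool × ℕ

SignedPerm : Set
SignedPerm = List Entry

-- a-th entry (1-indexed); default is irrelevant for valid a
entryAt : SignedPerm → ℕ → Entry
entryAt []       _             = (false , 0)
entryAt (x ∷ xs) zero          = (false , 0)
entryAt (x ∷ xs) (suc zero)    = x
entryAt (x ∷ xs) (suc (suc a)) = entryAt xs (suc a)

-- w(α) < 0 ?  For w(e_a) = ±e_{m_a}: a root c e_i + d e_j (i < j) is negative
-- iff the coefficient c of the smaller index is -1.
negImage : SignedPerm → Root → Bool
negImage w (minus a b) with entryAt w a | entryAt w b
... | (sa , ma) | (sb , mb) =
  if ma <ᵇ mb then sa else (if mb <ᵇ ma then not sb else false)
negImage w (plus a b) with entryAt w a | entryAt w b
... | (sa , ma) | (sb , mb) =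
  if ma <ᵇ mb then sa else (if mb <ᵇ ma then sb else false)

lam : ℕ → SignedPerm → RootSet
lam n w α = isPosRoot n α ∧ negImage w α

StrictInc : List ℕ → Set
StrictInc = Linked _<_

markLast : Bool → List ℕ → List Entry
markLast b []           = []
markLast b (x ∷ [])     = (b , x) ∷ []
markLast b (x ∷ y ∷ xs) = (false , x) ∷ markLast b (y ∷ xs)

-- Data of w = (y_1..y_{k-r}, \bar z_r .. \bar z_1, v_1 .. v_{n-k-1}, \hat v_{n-k}).
-- zs is stored as [z_1 , ... , z_r] (increasing).
record WOG (k n : ℕ) : Set where
  field
    r      : ℕ
    r≤k    : r ≤ k
    ys     : List ℕ
    zs     : List ℕ
    vs     : List ℕ
    len-ys : length ys ≡ k ∸ r
    len-zs : length zs ≡ r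
    len-vs : length vs ≡ n ∸ k
    inc-ys : StrictInc ys
    inc-zs : StrictInc zs
    inc-vs : StrictInc vs
    perm   : (ys ++ zs ++ vs) ↭ between 1 n

-- the last entry is barred iff r is odd (even number of bars in total)
lastBarred : ∀ {k n} → WOG k n → Bool
lastBarred w = odd (WOG.r w)

toPerm : ∀ {k n} → WOG k n → SignedPerm
toPerm w = map (false ,_) (WOG.ys w)
        ++ map (true ,_) (reverse (WOG.zs w))
        ++ markLast (lastBarred w) (WOG.vs w)

typeI : ∀ {k n} → WOG k n → Bool
typeI w = not (lastBarred w)

S1 : ℕ → ℕ → RootSet → ℕ → ℕ
S1 k n S i = count (map (λ c → S (minus (suc k ∸ i) c)) (between (suc k) n))
           + count (map (λ c → S (plus  (suc k ∸ i) c)) (between (suc k) n))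

S2 : ℕ → RootSet → ℕ → ℕ
S2 k S i = count (map (λ a → S (plus a (suc k ∸ i))) (between 1 (k ∸ i)))

assignedUp : ℕ → ℕ → RootSet → Bool
assignedUp k n S =
  any (λ i → (S1 k n S i ≡ᵇ (n ∸ k)) ∧ S (minus (suc k ∸ i) n)) (between 1 k)

assignedDown : ℕ → ℕ → RootSet → Bool
assignedDown k n S =
  any (λ i → (S1 k n S i ≡ᵇ (n ∸ k)) ∧ S (plus (suc k ∸ i) n)) (between 1 k)

-- pairs (γ ; t), γ written as a length-k sequence padded with zeros
PartT : Set
PartT = List ℕ × ℕ

Fk : ℕ → ℕ → RootSet → PartT
Fk k n S =
  ( map (λ i → S1 k n S i + S2 k S i) (between 1 k)
  , (if assignedUp k n S then 1 else (if assignedDown k n S then 2 else 0)) )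

StrictStep : ℕ → ℕ → ℕ → Set
StrictStep p x y = (y ≤ x) × (p < x → y < x)

InPtilde : ℕ → ℕ → PartT → Set
InPtilde k n (γ , t) =
  (length γ ≡ k)
  × Linked (StrictStep (n ∸ k)) γ
  × All (_≤ (2 * n ∸ 1 ∸ k)) γ
  × ((¬ ((n ∸ k) ∈ γ) × t ≡ 0) ⊎ (((n ∸ k) ∈ γ) × (t ≡ 1 ⊎ t ≡ 2)))
  where open import Data.Nat using (_*_)

countLess : ℕ → List ℕ → ℕ
countLess y vs = count (map (λ v → v <ᵇ y) vs)

gammaTilde : ∀ {k n} → WOG k n → PartT
gammaTilde {k} {n} w =
  ( γ
  , (if any (λ x → x ≡ᵇ (n ∸ k)) γ then (if typeI w then 1 else 2) else 0) )
  where
  γ : List ℕ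
  γ = map (λ z → (n ∸ k) + (n ∸ z)) (WOG.zs w)
   ++ map (λ y → countLess y (WOG.vs w)) (reverse (WOG.ys w))

module Submission where

-- Write w ∈ W^{OG(k,2n)} as (y, z̄, v).
-- Reading λ(w) row by row (module OfW): the row of a barred z has S^(1) = (n-k) + #{v > z}
-- and S^(2) = #{y > z} + #{z' > z}, so its part is (n-k) + (n-z); the row of an unbarred y
-- has S^(1) = #{v < y} and S^(2) = 0.  A diamond is full exactly when n is not a v, i.e.
-- exactly when n-k is a part, and then the bar on the last entry decides ↑ or ↓.
-- Injectivity (module Compare): equal \tilde γ forces equal numbers of bars (using the tag
-- when n-k is a part), hence equal z's, equal complements, and equal splittings into
-- y's and v's, which are determined by the counts #{v < y}.
-- Surjectivity (module Preimage): the parts above n-k, adjusted by one part n-k to match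
-- the tag, give the z's; the remaining parts are realised as counts by splitting the
-- complement (split-by-counts).

open import Defs
open import Data.Nat using (ℕ; zero; suc; _+_; _∸_; _≤_; _<_; _<ᵇ_; _≡ᵇ_; z≤n; s≤s; _*_; pred)
open import Data.Nat.Properties
open import Data.Nat.Tactic.RingSolver using (solve-∀)
open import Data.Nat.ListAction using (sum)
open import Data.Bool using (Bool; true; false; if_then_else_; _∧_; not; T)
open import Data.Bool.Properties using (∧-zeroʳ)
open import Data.Bool.ListAction using (or; any)
open import Data.List using (List; []; _∷_; _++_; map; length; reverse; applyUpTo; [_])
open import Data.List.Properties
open import Data.List.Membership.Propositional using (_∈_)
open import Data.List.Membership.Propositional.Properties using (∈-++⁻; ∈-++⁺ˡ; ∈-++⁺ʳ; ∈-∃++; ∈-map⁺; ∈-map⁻)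
open import Data.List.Relation.Unary.Any using (here; there)
import Data.List.Relation.Unary.Any.Properties as AnyP
open import Data.List.Relation.Unary.All as All using (All; []; _∷_; lookup)
import Data.List.Relation.Unary.All.Properties as AllP
open import Data.List.Relation.Unary.Linked as Linked using (Linked; []; [-]; _∷_)
import Data.List.Relation.Unary.Linked.Properties as LinkedP
open import Data.List.Relation.Binary.Permutation.Propositional using (_↭_; prep; ↭-trans; ↭-refl; ↭-sym; ↭-reflexive)
open import Data.List.Relation.Binary.Permutation.Propositional.Properties using (↭-empty-inv; ∈-resp-↭; shift; shifts; drop-∷; ++⁺ˡ)
open import Data.Product using (_×_; _,_; proj₁; proj₂; Σ)
open import Data.Sum using (_⊎_; inj₁; inj₂)
open import Data.Empty using (⊥; ⊥-elim)
open import Relation.Nullary using (¬_; yes; no)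
open import Relation.Binary.Definitions using (tri<; tri≈; tri>)
open import Relation.Binary.PropositionalEquality hiding ([_])

<ᵇ-true : ∀ {m n} → m < n → (m <ᵇ n) ≡ true
<ᵇ-true {zero}  {suc n} _       = refl
<ᵇ-true {suc m} {suc n} (s≤s p) = <ᵇ-true p

<ᵇ-false : ∀ {m n} → n ≤ m → (m <ᵇ n) ≡ false
<ᵇ-false {m}     {zero}  _       = refl
<ᵇ-false {suc m} {suc n} (s≤s p) = <ᵇ-false p

<ᵇ-true⁻ : ∀ m n → (m <ᵇ n) ≡ true → m < n
<ᵇ-true⁻ m n e = <ᵇ⇒< m n (subst T (sym e) _)

<ᵇ-false⁻ : ∀ m n → (m <ᵇ n) ≡ false → n ≤ m
<ᵇ-false⁻ m n e with m <? n
... | yes p = ⊥-elim (subst (λ b → b ≡ false → ⊥) (sym (<ᵇ-true p)) (λ ()) e)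
... | no p  = ≮⇒≥ p

≡ᵇ-true⁻ : ∀ m n → (m ≡ᵇ n) ≡ true → m ≡ n
≡ᵇ-true⁻ m n e = ≡ᵇ⇒≡ m n (subst T (sym e) _)

≡ᵇ-refl : ∀ m → (m ≡ᵇ m) ≡ true
≡ᵇ-refl zero    = refl
≡ᵇ-refl (suc m) = ≡ᵇ-refl m

range : ℕ → ℕ → List ℕ
range s zero    = []
range s (suc m) = s ∷ range (suc s) m

applyUpTo-range : ∀ m (f : ℕ → ℕ) s → (∀ i → f i ≡ s + i) → applyUpTo f m ≡ range s m
applyUpTo-range zero    f s h = refl
applyUpTo-range (suc m) f s h =
  cong₂ _∷_ (trans (h 0) (+-identityʳ s))
    (applyUpTo-range m (λ i → f (suc i)) (suc s) (λ i → trans (h (suc i)) (+-suc s i)))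

between-range : ∀ a b → between a b ≡ range a (suc b ∸ a)
between-range a b = trans (map-applyUpTo (λ i → i) (a +_) (suc b ∸ a))
                          (applyUpTo-range (suc b ∸ a) (a +_) a (λ i → refl))

range-++ : ∀ s m m′ → range s (m + m′) ≡ range s m ++ range (s + m) m′
range-++ s zero    m′ = cong (λ t → range t m′) (sym (+-identityʳ s))
range-++ s (suc m) m′ =
  cong (s ∷_) (trans (range-++ (suc s) m m′) (cong (λ t → range (suc s) m ++ range t m′) (sym (+-suc s m))))

length-range : ∀ s m → length (range s m) ≡ m
length-range s zero    = refl
length-range s (suc m) = cong suc (length-range (suc s) m)

range-All : ∀ {P : ℕ → Set} s m → (∀ i → s ≤ i → i < s + m → P i) → All P (range s m)
range-All s zero    h = []
range-All s (suc m) h =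
  h s ≤-refl (subst (s <_) (sym (+-suc s m)) (s≤s (m≤m+n s m)))
  ∷ range-All (suc s) m (λ i si i< → h i (<⇒≤ si) (subst (i <_) (sym (+-suc s m)) i<))

∈-range⁻ : ∀ {x} s m → x ∈ range s m → s ≤ x × x < s + m
∈-range⁻ {x} s (suc m) (here refl) = ≤-refl , subst (x <_) (sym (+-suc x m)) (s≤s (m≤m+n x m))
∈-range⁻ {x} s (suc m) (there p) with ∈-range⁻ (suc s) m p
... | a , b = <⇒≤ a , subst (x <_) (sym (+-suc s m)) b

∈-range⁺ : ∀ {x} s m → s ≤ x → x < s + m → x ∈ range s m
∈-range⁺ s zero a b = ⊥-elim (<⇒≱ b (subst (_≤ _) (sym (+-identityʳ s)) a))
∈-range⁺ {x} s (suc m) a b with m≤n⇒m<n∨m≡n a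
... | inj₂ refl = here refl
... | inj₁ s<x  = there (∈-range⁺ (suc s) m s<x (subst (x <_) (+-suc s m) b))

+-left-comm : ∀ a b c → a + (b + c) ≡ b + (a + c)
+-left-comm = solve-∀

countIf : {A : Set} → (A → Bool) → List A → ℕ
countIf f l = count (map f l)

countIf-++ : {A : Set} (f : A → Bool) (xs ys : List A) → countIf f (xs ++ ys) ≡ countIf f xs + countIf f ys
countIf-++ f []       ys = refl
countIf-++ f (x ∷ xs) ys = trans (cong (b2n (f x) +_) (countIf-++ f xs ys)) (sym (+-assoc (b2n (f x)) _ _))

countIf-cong : {A : Set} {f g : A → Bool} {l : List A} → All (λ x → f x ≡ g x) l → countIf f l ≡ countIf g l
countIf-cong []       = refl
countIf-cong (e ∷ es) = cong₂ (λ a b → b2n a + b) e (countIf-cong es)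

countIf-map : {A B : Set} (g : B → Bool) (f : A → B) (l : List A) → countIf (λ x → g (f x)) l ≡ countIf g (map f l)
countIf-map g f l = cong count (map-∘ l)

countIf-reverse : {A : Set} (f : A → Bool) (xs : List A) → countIf f (reverse xs) ≡ countIf f xs
countIf-reverse f []       = refl
countIf-reverse f (x ∷ xs) = begin
  countIf f (reverse (x ∷ xs))            ≡⟨ cong (countIf f) (unfold-reverse x xs) ⟩
  countIf f (reverse xs ++ [ x ])         ≡⟨ countIf-++ f (reverse xs) [ x ] ⟩
  countIf f (reverse xs) + (b2n (f x) + 0) ≡⟨ cong₂ _+_ (countIf-reverse f xs) (+-identityʳ _) ⟩
  countIf f xs + b2n (f x)                ≡⟨ +-comm (countIf f xs) _ ⟩
  countIf f (x ∷ xs)                      ∎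
  where open ≡-Reasoning

countIf-none : {A : Set} {f : A → Bool} {l : List A} → All (λ x → f x ≡ false) l → countIf f l ≡ 0
countIf-none []       = refl
countIf-none (e ∷ es) rewrite e = countIf-none es

countIf-all : {A : Set} {f : A → Bool} {l : List A} → All (λ x → f x ≡ true) l → countIf f l ≡ length l
countIf-all []       = refl
countIf-all (e ∷ es) rewrite e = cong suc (countIf-all es)

countIf≤length : {A : Set} (f : A → Bool) (l : List A) → countIf f l ≤ length l
countIf≤length f []      = z≤n
countIf≤length f (x ∷ l) with f x
... | true  = s≤s (countIf≤length f l)
... | false = m≤n⇒m≤1+n (countIf≤length f l)

countIf-mono : {A : Set} (f h : A → Bool) (l : List A) → (∀ x → f x ≡ true → h x ≡ true) → countIf f l ≤ countIf h l
countIf-mono f h []      imp = z≤n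
countIf-mono f h (x ∷ l) imp with f x in ef | h x in eh
... | true  | true  = s≤s (countIf-mono f h l imp)
... | true  | false = ⊥-elim (false≢true (trans (sym eh) (imp x ef)))
  where false≢true : false ≡ true → ⊥
        false≢true ()
... | false | true  = m≤n⇒m≤1+n (countIf-mono f h l imp)
... | false | false = countIf-mono f h l imp

countIf≡length⇒all : {A : Set} (f : A → Bool) (l : List A) → countIf f l ≡ length l → All (λ x → f x ≡ true) l
countIf≡length⇒all f []      e = []
countIf≡length⇒all f (x ∷ l) e with f x in eq
... | true  = eq ∷ countIf≡length⇒all f l (suc-injective e)
... | false = ⊥-elim (<⇒≱ (s≤s ≤-refl) (subst (_≤ length l) e (countIf≤length f l)))

countIf≡0⇒none : {A : Set} (f : A → Bool) (l : List A) → countIf f l ≡ 0 → All (λ x → f x ≡ false) l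
countIf≡0⇒none f []      e = []
countIf≡0⇒none f (x ∷ l) e with f x in eq
... | false = eq ∷ countIf≡0⇒none f l e

countIf-range-above : ∀ z n → countIf (z <ᵇ_) (range 1 n) ≡ n ∸ z
countIf-range-above z n with ≤-total z n
... | inj₁ z≤n′ = begin
  countIf (z <ᵇ_) (range 1 n)
    ≡⟨ cong (countIf (z <ᵇ_)) (trans (cong (range 1) (sym (m+[n∸m]≡n z≤n′))) (range-++ 1 z (n ∸ z))) ⟩
  countIf (z <ᵇ_) (range 1 z ++ range (1 + z) (n ∸ z))
    ≡⟨ countIf-++ (z <ᵇ_) (range 1 z) _ ⟩
  countIf (z <ᵇ_) (range 1 z) + countIf (z <ᵇ_) (range (1 + z) (n ∸ z))
    ≡⟨ cong₂ _+_ (countIf-none (range-All 1 z (λ i _ h → <ᵇ-false (≤-pred h))))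
                 (trans (countIf-all (range-All (suc z) (n ∸ z) (λ i h _ → <ᵇ-true h))) (length-range (suc z) (n ∸ z))) ⟩
  n ∸ z ∎
  where open ≡-Reasoning
... | inj₂ n≤z = trans (countIf-none (range-All 1 n (λ i _ h → <ᵇ-false (≤-trans (≤-pred h) n≤z))))
                       (sym (m≤n⇒m∸n≡0 n≤z))

linked-head : ∀ {R : ℕ → ℕ → Set} → (∀ {a b c} → R a b → R b c → R a c) →
              ∀ {x xs} → Linked R (x ∷ xs) → All (R x) xs
linked-head tr [-]      = []
linked-head tr (r ∷ rs) = r ∷ All.map (tr r) (linked-head tr rs)

linked-∷ : ∀ {R : ℕ → ℕ → Set} {x xs} → All (R x) xs → Linked R xs → Linked R (x ∷ xs)
linked-∷ []      _ = [-]
linked-∷ (p ∷ _) i = p ∷ i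

linked-++ : ∀ {R : ℕ → ℕ → Set} {P Q : ℕ → Set} {xs ys} → Linked R xs → Linked R ys → All P xs → All Q ys →
            (∀ {x y} → P x → Q y → R x y) → Linked R (xs ++ ys)
linked-++ []       ly _ _ h = ly
linked-++ {xs = x ∷ []} {[]}     [-] ly _          _        h = [-]
linked-++ {xs = x ∷ []} {y ∷ ys} [-] ly (px ∷ []) (qy ∷ _) h = h px qy ∷ ly
linked-++ (r ∷ lx) ly (_ ∷ ps) qs h = r ∷ linked-++ lx ly ps qs h

linked-++ˡ : ∀ {R : ℕ → ℕ → Set} A {B} → Linked R (A ++ B) → Linked R A
linked-++ˡ []           _        = []
linked-++ˡ (a ∷ [])     _        = [-]
linked-++ˡ (a ∷ a′ ∷ A) (r ∷ rs) = r ∷ linked-++ˡ (a′ ∷ A) rs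

linked-++ʳ : ∀ {R : ℕ → ℕ → Set} A {B} → Linked R (A ++ B) → Linked R B
linked-++ʳ []      i = i
linked-++ʳ (a ∷ A) i = linked-++ʳ A (Linked.tail i)

linked-reverse : ∀ {R : ℕ → ℕ → Set} → (∀ {a b c} → R a b → R b c → R a c) →
                 ∀ {xs} → Linked R xs → Linked (λ a b → R b a) (reverse xs)
linked-reverse tr {[]}     _ = []
linked-reverse {R} tr {x ∷ xs} i = subst (Linked (λ a b → R b a)) (sym (unfold-reverse x xs))
  (linked-++ {P = R x} {Q = _≡ x} (linked-reverse tr (Linked.tail i)) [-]
     (All.tabulate (λ m → lookup (linked-head tr i) (AnyP.reverse⁻ m))) (refl ∷ []) (λ { px refl → px }))

linked-map : ∀ {R S : ℕ → ℕ → Set} {P : ℕ → Set} (f : ℕ → ℕ) {xs} → All P xs →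
             (∀ {a b} → P a → P b → R a b → S (f a) (f b)) → Linked R xs → Linked S (map f xs)
linked-map f _                 h []       = []
linked-map f _                 h [-]      = [-]
linked-map f (pa ∷ pb ∷ ps) h (r ∷ rs) = h pa pb r ∷ linked-map f (pb ∷ ps) h rs

Inc : List ℕ → Set
Inc = StrictInc

inc-head : ∀ {x xs} → Inc (x ∷ xs) → All (x <_) xs
inc-head = linked-head <-trans

inc-split : ∀ A {x B} → Inc (A ++ x ∷ B) → All (_< x) A × All (x <_) B
inc-split []      i = [] , inc-head i
inc-split (a ∷ A) i =
  (lookup (inc-head i) (∈-++⁺ʳ A (here refl)) ∷ proj₁ (inc-split A (Linked.tail i))) , proj₂ (inc-split A (Linked.tail i))

range-inc : ∀ s m → Inc (range s m)
range-inc s zero    = []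
range-inc s (suc m) = linked-∷ (range-All (suc s) m (λ i si _ → si)) (range-inc (suc s) m)

data Interleave : List ℕ → List ℕ → List ℕ → Set where
  []  : Interleave [] [] []
  l∷ : ∀ x {A C L} → Interleave A C L → Interleave (x ∷ A) C (x ∷ L)
  r∷ : ∀ x {A C L} → Interleave A C L → Interleave A (x ∷ C) (x ∷ L)

interleave-∈ˡ : ∀ {A C L x} → Interleave A C L → x ∈ A → x ∈ L
interleave-∈ˡ (l∷ x il) (here refl) = here refl
interleave-∈ˡ (l∷ x il) (there p)   = there (interleave-∈ˡ il p)
interleave-∈ˡ (r∷ x il) p           = there (interleave-∈ˡ il p)

interleave-∈ʳ : ∀ {A C L x} → Interleave A C L → x ∈ C → x ∈ L
interleave-∈ʳ (r∷ x il) (here refl) = here refl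
interleave-∈ʳ (r∷ x il) (there p)   = there (interleave-∈ʳ il p)
interleave-∈ʳ (l∷ x il) p           = there (interleave-∈ʳ il p)

interleave-∈⁻ : ∀ {A C L x} → Interleave A C L → x ∈ L → x ∈ A ⊎ x ∈ C
interleave-∈⁻ (l∷ x il) (here refl) = inj₁ (here refl)
interleave-∈⁻ (r∷ x il) (here refl) = inj₂ (here refl)
interleave-∈⁻ (l∷ x il) (there p) with interleave-∈⁻ il p
... | inj₁ q = inj₁ (there q)
... | inj₂ q = inj₂ q
interleave-∈⁻ (r∷ x il) (there p) with interleave-∈⁻ il p
... | inj₁ q = inj₁ q
... | inj₂ q = inj₂ (there q)

interleave-Allˡ : ∀ {P : ℕ → Set} {A C L} → Interleave A C L → All P L → All P A
interleave-Allˡ []        []       = []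
interleave-Allˡ (l∷ x il) (p ∷ ps) = p ∷ interleave-Allˡ il ps
interleave-Allˡ (r∷ x il) (p ∷ ps) = interleave-Allˡ il ps

interleave-Allʳ : ∀ {P : ℕ → Set} {A C L} → Interleave A C L → All P L → All P C
interleave-Allʳ []        []       = []
interleave-Allʳ (r∷ x il) (p ∷ ps) = p ∷ interleave-Allʳ il ps
interleave-Allʳ (l∷ x il) (p ∷ ps) = interleave-Allʳ il ps

interleave-incˡ : ∀ {A C L} → Interleave A C L → Inc L → Inc A
interleave-incˡ []        _ = []
interleave-incˡ (l∷ x il) i = linked-∷ (interleave-Allˡ il (inc-head i)) (interleave-incˡ il (Linked.tail i))
interleave-incˡ (r∷ x il) i = interleave-incˡ il (Linked.tail i)

interleave-incʳ : ∀ {A C L} → Interleave A C L → Inc L → Inc C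
interleave-incʳ []        _ = []
interleave-incʳ (r∷ x il) i = linked-∷ (interleave-Allʳ il (inc-head i)) (interleave-incʳ il (Linked.tail i))
interleave-incʳ (l∷ x il) i = interleave-incʳ il (Linked.tail i)

interleave-countIf : ∀ (f : ℕ → Bool) {A C L} → Interleave A C L → countIf f L ≡ countIf f A + countIf f C
interleave-countIf f []        = refl
interleave-countIf f (l∷ x il) = trans (cong (b2n (f x) +_) (interleave-countIf f il)) (sym (+-assoc (b2n (f x)) _ _))
interleave-countIf f {A} {x ∷ C} (r∷ x il) =
  trans (cong (b2n (f x) +_) (interleave-countIf f il)) (+-left-comm (b2n (f x)) (countIf f A) (countIf f C))

interleave-length : ∀ {A C L} → Interleave A C L → length L ≡ length A + length C
interleave-length []        = refl
interleave-length (l∷ x il) = cong suc (interleave-length il)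
interleave-length {A} {x ∷ C} (r∷ x il) = trans (cong suc (interleave-length il)) (sym (+-suc (length A) (length C)))

interleave-↭ : ∀ {A C L} → Interleave A C L → A ++ C ↭ L
interleave-↭ []        = ↭-refl
interleave-↭ (l∷ x il) = prep x (interleave-↭ il)
interleave-↭ {A} {x ∷ C} (r∷ x il) = ↭-trans (shift x A C) (prep x (interleave-↭ il))

interleave-[]ʳ : ∀ {A L} → Interleave A [] L → A ≡ L
interleave-[]ʳ []        = refl
interleave-[]ʳ (l∷ x il) = cong (x ∷_) (interleave-[]ʳ il)

interleave-disjoint : ∀ {A C L x} → Interleave A C L → Inc L → x ∈ A → x ∈ C → ⊥
interleave-disjoint (l∷ y il) i (here refl) q = <-irrefl refl (lookup (inc-head i) (interleave-∈ʳ il q))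
interleave-disjoint (l∷ y il) i (there p)   q = interleave-disjoint il (Linked.tail i) p q
interleave-disjoint (r∷ y il) i p (here refl) = <-irrefl refl (lookup (inc-head i) (interleave-∈ˡ il p))
interleave-disjoint (r∷ y il) i p (there q)   = interleave-disjoint il (Linked.tail i) p q

interleave-unique : ∀ {A C C′ L} → Inc L → Interleave A C L → Interleave A C′ L → C ≡ C′
interleave-unique i []        []         = refl
interleave-unique i (l∷ x il) (l∷ .x il′) = interleave-unique (Linked.tail i) il il′
interleave-unique i (r∷ x il) (r∷ .x il′) = cong (x ∷_) (interleave-unique (Linked.tail i) il il′)
interleave-unique i (l∷ x il) (r∷ .x il′) = ⊥-elim (<-irrefl refl (lookup (inc-head i) (interleave-∈ˡ il′ (here refl))))
interleave-unique i (r∷ x il) (l∷ .x il′) = ⊥-elim (<-irrefl refl (lookup (inc-head i) (interleave-∈ˡ il (here refl))))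

head-in-complement : ∀ l L A B → Inc A → Inc (l ∷ L) → A ++ B ↭ l ∷ L → (∀ {A′} → A ≡ l ∷ A′ → ⊥) → l ∈ B
head-in-complement l L []       B iA iL p ne = ∈-resp-↭ (↭-sym p) (here refl)
head-in-complement l L (a ∷ A′) B iA iL p ne with ∈-resp-↭ (↭-sym p) (here refl)
... | here refl = ⊥-elim (ne refl)
... | there q with ∈-++⁻ A′ q
...   | inj₂ q′ = q′
...   | inj₁ q′ with ∈-resp-↭ p (here {xs = A′ ++ B} refl)
...     | here refl = ⊥-elim (<-irrefl refl (lookup (inc-head iA) q′))
...     | there aL  = ⊥-elim (<-asym (lookup (inc-head iA) q′) (lookup (inc-head iL) aL))

interleave-of-↭ : ∀ L A B → Inc A → Inc L → A ++ B ↭ L → Σ (List ℕ) (λ C → Interleave A C L × B ↭ C)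
interleave-of-↭ [] A B iA iL p with ++-conicalˡ A B (↭-empty-inv p) | ++-conicalʳ A B (↭-empty-inv p)
... | refl | refl = [] , [] , ↭-refl
interleave-of-↭ (l ∷ L) A B iA iL p = byHead A refl
  where
  fromComplement : l ∈ B → Σ (List ℕ) (λ C → Interleave A C (l ∷ L) × B ↭ C)
  fromComplement q with ∈-∃++ q
  ... | B1 , B2 , refl with interleave-of-↭ L A (B1 ++ B2) iA (Linked.tail iL)
        (drop-∷ (↭-trans (↭-sym (shifts A (l ∷ []) {B1 ++ B2})) (↭-trans (++⁺ˡ A (↭-sym (shift l B1 B2))) p)))
  ... | C , il , pB = l ∷ C , r∷ l il , ↭-trans (shift l B1 B2) (prep l pB)
  byHead : ∀ A₀ → A₀ ≡ A → Σ (List ℕ) (λ C → Interleave A C (l ∷ L) × B ↭ C)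
  byHead [] refl = fromComplement (head-in-complement l L A B iA iL p (λ ()))
  byHead (a ∷ A′) refl with a ≟ l
  ... | yes refl with interleave-of-↭ L A′ B (Linked.tail iA) (Linked.tail iL) (drop-∷ p)
  ...   | C , il , pB = C , l∷ l il , pB
  byHead (a ∷ A′) refl | no a≢l = fromComplement (head-in-complement l L A B iA iL p (λ { refl → a≢l refl }))

∈-tail : ∀ {x l : ℕ} {L} → x ∈ l ∷ L → x ≢ l → x ∈ L
∈-tail (here e)  ne = ⊥-elim (ne e)
∈-tail (there q) ne = q

complement : ∀ A L → Inc A → Inc L → All (_∈ L) A → Σ (List ℕ) (λ C → Interleave A C L)
complement []      []      _  _  _ = [] , []
complement (a ∷ A) []      _  _  (() ∷ _)
complement []      (l ∷ L) iA iL _ with complement [] L [] (Linked.tail iL) []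
... | C , il = l ∷ C , r∷ l il
complement (a ∷ A) (l ∷ L) iA iL (aL ∷ AL) with a ≟ l
... | yes refl with complement A L (Linked.tail iA) (Linked.tail iL)
        (All.zipWith (λ (q , lt) → ∈-tail q (λ e → <-irrefl (sym e) lt)) (AL , inc-head iA))
...   | C , il = C , l∷ a il
complement (a ∷ A) (l ∷ L) iA iL (aL ∷ AL) | no a≢l with complement (a ∷ A) L iA (Linked.tail iL)
        (a∈L ∷ All.zipWith (λ (q , lt) → ∈-tail q (λ e → <-asym (subst (_< a) (sym e) l<a) lt)) (AL , inc-head iA))
  where
  a∈L : a ∈ L
  a∈L = ∈-tail aL a≢l
  l<a : l < a
  l<a = lookup (inc-head iL) a∈L
... | C , il = l ∷ C , r∷ l il

-- For entries e = w(e_a), e′ = w(e_b) with a < b,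
-- the roots e_a - e_b and e_a + e_b are inversions of w iff invMinus e e′,
-- respectively invPlus e e′, holds.

invMinus : Entry → Entry → Bool
invMinus (sa , ma) (sb , mb) = if ma <ᵇ mb then sa else (if mb <ᵇ ma then not sb else false)

invPlus : Entry → Entry → Bool
invPlus (sa , ma) (sb , mb) = if ma <ᵇ mb then sa else (if mb <ᵇ ma then sb else false)

positive-roots : ∀ n a b → 1 ≤ a → a < b → b ≤ n →
                 (isPosRoot n (minus a b) ≡ true) × (isPosRoot n (plus a b) ≡ true)
positive-roots n a b h1 h2 h3 rewrite <ᵇ-true h1 | <ᵇ-true h2 | <ᵇ-true (s≤s h3) = refl , refl

lam-minus : ∀ n w a b → 1 ≤ a → a < b → b ≤ n → lam n w (minus a b) ≡ invMinus (entryAt w a) (entryAt w b)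
lam-minus n w a b h1 h2 h3 rewrite proj₁ (positive-roots n a b h1 h2 h3) with entryAt w a | entryAt w b
... | _ | _ = refl

lam-plus : ∀ n w a b → 1 ≤ a → a < b → b ≤ n → lam n w (plus a b) ≡ invPlus (entryAt w a) (entryAt w b)
lam-plus n w a b h1 h2 h3 rewrite proj₂ (positive-roots n a b h1 h2 h3) with entryAt w a | entryAt w b
... | _ | _ = refl

entryAt-++ : ∀ (Q X : List Entry) j → entryAt (Q ++ X) (suc (length Q + j)) ≡ entryAt X (suc j)
entryAt-++ []      X j = refl
entryAt-++ (q ∷ Q) X j = entryAt-++ Q X j

entryAt-middle : ∀ (Q : List Entry) e X → entryAt (Q ++ e ∷ X) (suc (length Q)) ≡ e
entryAt-middle Q e X =
  trans (cong (λ t → entryAt (Q ++ e ∷ X) (suc t)) (sym (+-identityʳ (length Q)))) (entryAt-++ Q (e ∷ X) 0)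

map-entryAt : ∀ (Q B D : List Entry) → map (entryAt (Q ++ B ++ D)) (range (suc (length Q)) (length B)) ≡ B
map-entryAt Q []      D = refl
map-entryAt Q (b ∷ B) D = cong₂ _∷_ (entryAt-middle Q b (B ++ D)) (begin
  map (entryAt (Q ++ b ∷ B ++ D)) (range (suc (suc (length Q))) (length B))
    ≡⟨ cong₂ (λ P s → map (entryAt P) (range s (length B))) (sym (++-assoc Q [ b ] (B ++ D))) (cong suc (sym lengthQb)) ⟩
  map (entryAt ((Q ++ [ b ]) ++ B ++ D)) (range (suc (length (Q ++ [ b ]))) (length B))
    ≡⟨ map-entryAt (Q ++ [ b ]) B D ⟩
  B ∎)
  where
  open ≡-Reasoning
  lengthQb : length (Q ++ [ b ]) ≡ suc (length Q)
  lengthQb = trans (length-++ Q) (+-comm (length Q) 1)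

markLast-length : ∀ b vs → length (markLast b vs) ≡ length vs
markLast-length b []           = refl
markLast-length b (x ∷ [])     = refl
markLast-length b (x ∷ y ∷ xs) = cong suc (markLast-length b (y ∷ xs))

markLast-snoc : ∀ b vs vl → markLast b (vs ++ vl ∷ []) ≡ map (false ,_) vs ++ (b , vl) ∷ []
markLast-snoc b []           vl = refl
markLast-snoc b (x ∷ [])     vl = refl
markLast-snoc b (x ∷ y ∷ vs) vl = cong ((false , x) ∷_) (markLast-snoc b (y ∷ vs) vl)

nonempty-snoc : ∀ (l : List ℕ) → 1 ≤ length l → Σ (List ℕ) (λ i → Σ ℕ (λ v → l ≡ i ++ v ∷ []))
nonempty-snoc (x ∷ [])     _ = [] , x , refl
nonempty-snoc (x ∷ y ∷ xs) _ with nonempty-snoc (y ∷ xs) (s≤s z≤n)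
... | i , l , e = x ∷ i , l , cong (x ∷_) e

-- The number of inversions e_a ± e_c between a fixed entry e and the v-block depends
-- only on the unsigned values of the v-block, whatever the bar on its last entry.
pairCount : Entry → List Entry → ℕ
pairCount e V = countIf (invMinus e) V + countIf (invPlus e) V

pairCount-markLast : ∀ e (h : ℕ → ℕ) b vs →
  All (λ v → ∀ s → b2n (invMinus e (s , v)) + b2n (invPlus e (s , v)) ≡ h v) vs →
  pairCount e (markLast b vs) ≡ sum (map h vs)
pairCount-markLast e h b []           _        = refl
pairCount-markLast e h b (x ∷ [])     (p ∷ []) =
  trans (cong₂ _+_ (+-identityʳ (b2n (invMinus e (b , x)))) (+-identityʳ (b2n (invPlus e (b , x)))))
        (trans (p b) (sym (+-identityʳ (h x))))
pairCount-markLast e h b (x ∷ y ∷ vs) (p ∷ ps) = begin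
  (m₀ + countIf (invMinus e) V) + (p₀ + countIf (invPlus e) V)
    ≡⟨ +-interchange m₀ _ p₀ _ ⟩
  (m₀ + p₀) + pairCount e V
    ≡⟨ cong₂ _+_ (p false) (pairCount-markLast e h b (y ∷ vs) ps) ⟩
  h x + sum (map h (y ∷ vs)) ∎
  where
  open ≡-Reasoning
  V  = markLast b (y ∷ vs)
  m₀ = b2n (invMinus e (false , x))
  p₀ = b2n (invPlus e (false , x))
  +-interchange : ∀ a b c d → (a + b) + (c + d) ≡ (a + c) + (b + d)
  +-interchange = solve-∀

sum-b2n : {A : Set} (f : A → Bool) (l : List A) → sum (map (λ x → b2n (f x)) l) ≡ countIf f l
sum-b2n f l = cong sum (map-∘ l)

sum-suc-b2n : (f : ℕ → Bool) (l : List ℕ) → sum (map (λ x → suc (b2n (f x))) l) ≡ length l + countIf f l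
sum-suc-b2n f []      = refl
sum-suc-b2n f (x ∷ l) = cong suc (begin
  b2n (f x) + sum (map (λ x → suc (b2n (f x))) l) ≡⟨ cong (b2n (f x) +_) (sum-suc-b2n f l) ⟩
  b2n (f x) + (length l + countIf f l)           ≡⟨ +-left-comm (b2n (f x)) (length l) _ ⟩
  length l + countIf f (x ∷ l)                   ∎)
  where open ≡-Reasoning

pairInv-unbarred : ∀ y v s → v ≢ y → b2n (invMinus (false , y) (s , v)) + b2n (invPlus (false , y) (s , v)) ≡ b2n (v <ᵇ y)
pairInv-unbarred y v s ne with <-cmp y v
... | tri< a _ _ rewrite <ᵇ-true a | <ᵇ-false (<⇒≤ a) = refl
... | tri≈ _ b _ = ⊥-elim (ne (sym b))
... | tri> _ _ c rewrite <ᵇ-false (<⇒≤ c) | <ᵇ-true c with s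
...   | true  = refl
...   | false = refl

pairInv-barred : ∀ z v s → v ≢ z → b2n (invMinus (true , z) (s , v)) + b2n (invPlus (true , z) (s , v)) ≡ suc (b2n (z <ᵇ v))
pairInv-barred z v s ne with <-cmp z v
... | tri< a _ _ rewrite <ᵇ-true a = refl
... | tri≈ _ b _ = ⊥-elim (ne (sym b))
... | tri> _ _ c rewrite <ᵇ-false (<⇒≤ c) | <ᵇ-true c with s
...   | true  = refl
...   | false = refl

invPlus-unbarred-unbarred : ∀ y′ y → y′ < y → invPlus (false , y′) (false , y) ≡ false
invPlus-unbarred-unbarred y′ y p rewrite <ᵇ-true p = refl

invPlus-unbarred-barred : ∀ y z → invPlus (false , y) (true , z) ≡ (z <ᵇ y)
invPlus-unbarred-barred y z with <-cmp y z
... | tri< a _ _  rewrite <ᵇ-true a | <ᵇ-false (<⇒≤ a) = refl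
... | tri≈ _ refl _ rewrite <ᵇ-false (≤-refl {y}) = refl
... | tri> _ _ c  rewrite <ᵇ-false (<⇒≤ c) | <ᵇ-true c = refl

invPlus-barred-barred : ∀ z′ z → z < z′ → invPlus (true , z′) (true , z) ≡ true
invPlus-barred-barred z′ z p rewrite <ᵇ-false (<⇒≤ p) | <ᵇ-true p = refl

invMinus-last : ∀ s m b vl → vl < m → invMinus (s , m) (b , vl) ≡ not b
invMinus-last s m b vl p rewrite <ᵇ-false (<⇒≤ p) | <ᵇ-true p = refl

invPlus-last : ∀ s m b vl → vl < m → invPlus (s , m) (b , vl) ≡ b
invPlus-last s m b vl p rewrite <ᵇ-false (<⇒≤ p) | <ᵇ-true p = refl

inversions-with-suffix : ∀ n (Q V : List Entry) a e (root : ℕ → ℕ → Root) (inv : Entry → Entry → Bool) →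
  length V ≡ n ∸ length Q → length Q ≤ n → 1 ≤ a → a ≤ length Q → entryAt (Q ++ V) a ≡ e →
  (∀ c → 1 ≤ a → a < c → c ≤ n → lam n (Q ++ V) (root a c) ≡ inv (entryAt (Q ++ V) a) (entryAt (Q ++ V) c)) →
  countIf (λ c → lam n (Q ++ V) (root a c)) (range (suc (length Q)) (n ∸ length Q)) ≡ countIf (inv e) V
inversions-with-suffix n Q V a e root inv lV Q≤n 1≤a a≤Q eA lam-root = begin
  countIf (λ c → lam n (Q ++ V) (root a c)) positions
    ≡⟨ countIf-cong (range-All (suc (length Q)) (n ∸ length Q) (λ c h1 h2 →
         trans (lam-root c 1≤a (≤-<-trans a≤Q h1) (subst (c ≤_) (m+[n∸m]≡n Q≤n) (≤-pred h2)))
               (cong (λ t → inv t (entryAt (Q ++ V) c)) eA))) ⟩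
  countIf (λ c → inv e (entryAt (Q ++ V) c)) positions
    ≡⟨ countIf-map (inv e) (entryAt (Q ++ V)) positions ⟩
  countIf (inv e) (map (entryAt (Q ++ V)) positions)
    ≡⟨ cong (countIf (inv e)) readV ⟩
  countIf (inv e) V ∎
  where
  open ≡-Reasoning
  positions = range (suc (length Q)) (n ∸ length Q)
  readV : map (entryAt (Q ++ V)) positions ≡ V
  readV = subst (λ m → map (entryAt (Q ++ V)) (range (suc (length Q)) m) ≡ V) lV
            (subst (λ X → map (entryAt (Q ++ X)) (range (suc (length Q)) (length V)) ≡ V) (++-identityʳ V)
              (map-entryAt Q V []))

S1-pairCount : ∀ n k i (Q V : List Entry) a e → length Q ≡ k → length V ≡ n ∸ k → k ≤ n →
  suc k ∸ i ≡ a → 1 ≤ a → a ≤ k → entryAt (Q ++ V) a ≡ e →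
  S1 k n (lam n (Q ++ V)) i ≡ pairCount e V
S1-pairCount n k i Q V a e refl lV k≤n refl 1≤a a≤k eA rewrite between-range (suc (length Q)) n =
  cong₂ _+_ (inversions-with-suffix n Q V a e minus invMinus lV k≤n 1≤a a≤k eA (lam-minus n (Q ++ V) a))
            (inversions-with-suffix n Q V a e plus  invPlus  lV k≤n 1≤a a≤k eA (lam-plus n (Q ++ V) a))

S2-prefix : ∀ n k i (pre post : List Entry) e → suc k ∸ i ≡ suc (length pre) → k ∸ i ≡ length pre →
  suc (length pre) ≤ n → S2 k (lam n (pre ++ e ∷ post)) i ≡ countIf (λ e′ → invPlus e′ e) pre
S2-prefix n k i pre post e ea eb h rewrite ea | eb | between-range 1 (length pre) = begin
  countIf (λ c → lam n P (plus c (suc (length pre)))) (range 1 (length pre))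
    ≡⟨ countIf-cong (range-All 1 (length pre) (λ c h1 h2 →
         trans (lam-plus n P c (suc (length pre)) h1 h2 h) (cong (invPlus (entryAt P c)) (entryAt-middle pre e post)))) ⟩
  countIf (λ c → invPlus (entryAt P c) e) (range 1 (length pre))
    ≡⟨ countIf-map (λ e′ → invPlus e′ e) (entryAt P) (range 1 (length pre)) ⟩
  countIf (λ e′ → invPlus e′ e) (map (entryAt P) (range 1 (length pre)))
    ≡⟨ cong (countIf (λ e′ → invPlus e′ e)) (map-entryAt [] pre (e ∷ post)) ⟩
  countIf (λ e′ → invPlus e′ e) pre ∎
  where
  open ≡-Reasoning
  P = pre ++ e ∷ post

map-range-by-elements : {B : Set} (X : List ℕ) (s : ℕ) (G : ℕ → B) (F : ℕ → B) →
  (∀ pre x post → X ≡ pre ++ x ∷ post → G (s + length pre) ≡ F x) → map G (range s (length X)) ≡ map F X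
map-range-by-elements []      s G F h = refl
map-range-by-elements (x ∷ X) s G F h =
  cong₂ _∷_ (trans (cong G (sym (+-identityʳ s))) (h [] x X refl))
    (map-range-by-elements X (suc s) G F (λ pre y post e →
       trans (cong G (sym (+-suc s (length pre)))) (h (x ∷ pre) y post (cong (x ∷_) e))))

or⁻ : ∀ (bs : List Bool) → or bs ≡ true → true ∈ bs
or⁻ (true ∷ bs)  e = here refl
or⁻ (false ∷ bs) e = there (or⁻ bs e)

or⁺ : ∀ (bs : List Bool) → true ∈ bs → or bs ≡ true
or⁺ (true ∷ bs)  _         = refl
or⁺ (false ∷ bs) (there q) = or⁺ bs q

or-∧ : ∀ (bs : List Bool) b → or (map (_∧ b) bs) ≡ or bs ∧ b
or-∧ []           b     = refl
or-∧ (true ∷ bs)  true  = refl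
or-∧ (true ∷ bs)  false = trans (or-∧ bs false) (∧-zeroʳ (or bs))
or-∧ (false ∷ bs) b     = or-∧ bs b

bool-ext : ∀ {a b : Bool} → (a ≡ true → b ≡ true) → (b ≡ true → a ≡ true) → a ≡ b
bool-ext {false} {false} f g = refl
bool-ext {false} {true}  f g = g refl
bool-ext {true}  {false} f g = sym (f refl)
bool-ext {true}  {true}  f g = refl

any-≡ᵇ⁺ : ∀ p (L : List ℕ) → p ∈ L → any (_≡ᵇ p) L ≡ true
any-≡ᵇ⁺ p L p∈L = or⁺ _ (subst (_∈ map (_≡ᵇ p) L) (≡ᵇ-refl p) (∈-map⁺ (_≡ᵇ p) p∈L))

any-≡ᵇ⁻ : ∀ p (L : List ℕ) → any (_≡ᵇ p) L ≡ true → p ∈ L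
any-≡ᵇ⁻ p L e with ∈-map⁻ (_≡ᵇ p) (or⁻ _ e)
... | x , x∈L , t = subst (_∈ L) (≡ᵇ-true⁻ x p (sym t)) x∈L

record Layout (ys zs vs : List ℕ) (n : ℕ) : Set where
  field
    C   : List ℕ
    ilz : Interleave zs C (range 1 n)
    ily : Interleave ys vs C

layout : ∀ n ys zs vs → Inc ys → Inc zs → Inc vs → (ys ++ zs ++ vs) ↭ between 1 n → Layout ys zs vs n
layout n ys zs vs iy iz iv p
  with interleave-of-↭ (range 1 n) zs (ys ++ vs) iz (range-inc 1 n)
         (↭-trans (↭-sym (shifts ys zs)) (↭-trans p (↭-reflexive (between-range 1 n))))
... | C , ilz , q with interleave-of-↭ C ys vs iy (interleave-incʳ ilz (range-inc 1 n)) q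
... | C2 , il2 , q2 with interleave-of-↭ C2 vs [] iv (interleave-incʳ il2 (interleave-incʳ ilz (range-inc 1 n)))
                           (↭-trans (↭-reflexive (++-identityʳ vs)) q2)
... | C3 , il3 , q3 with ↭-empty-inv (↭-sym q3)
... | refl with interleave-[]ʳ il3
... | refl = record { C = C ; ilz = ilz ; ily = il2 }

-- Position arithmetic: with k = A + (x + 1 + y), row x + 1 of λ(w) sits at position A + y + 1,
-- and with k = (x + 1 + y) + r, row r + x + 1 sits at position y + 1.
∸-by-decomposition : ∀ {a} b c → a ≡ b + c → a ∸ c ≡ b
∸-by-decomposition b c refl = m+n∸n≡m b c

position-z : ∀ A x y → (A + (x + suc y)) ∸ x ≡ suc (A + y)
position-z A x y = ∸-by-decomposition (suc (A + y)) x (decompose A x y)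
  where
  decompose : ∀ A x y → A + (x + suc y) ≡ suc (A + y) + x
  decompose = solve-∀

position-z′ : ∀ A x y → (A + (x + suc y)) ∸ suc x ≡ A + y
position-z′ A x y = ∸-by-decomposition (A + y) (suc x) (decompose A x y)
  where
  decompose : ∀ A x y → A + (x + suc y) ≡ (A + y) + suc x
  decompose = solve-∀

position-y : ∀ x y r → ((x + suc y) + r) ∸ (r + x) ≡ suc y
position-y x y r = ∸-by-decomposition (suc y) (r + x) (decompose x y r)
  where
  decompose : ∀ x y r → (x + suc y) + r ≡ suc y + (r + x)
  decompose = solve-∀

position-y′ : ∀ x y r → ((x + suc y) + r) ∸ suc (r + x) ≡ y
position-y′ x y r = ∸-by-decomposition y (suc (r + x)) (decompose x y r)
  where
  decompose : ∀ x y r → (x + suc y) + r ≡ y + suc (r + x)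
  decompose = solve-∀

bound-split : ∀ n k → 1 ≤ n → k ≤ n → (n ∸ k) + (n ∸ 1) ≡ 2 * n ∸ 1 ∸ k
bound-split n k 1≤n k≤n =
  sym (trans (cong (_∸ k) (trans (+-∸-assoc n {n + 0} {1} (≤-trans 1≤n (≤-reflexive (sym (+-identityʳ n)))))
                                 (cong (λ t → n + (t ∸ 1)) (+-identityʳ n))))
             (+-∸-comm (n ∸ 1) k≤n))

reverse-middle : ∀ (A : List ℕ) x B → reverse (A ++ x ∷ B) ≡ reverse B ++ x ∷ reverse A
reverse-middle A x B =
  trans (reverse-++ A (x ∷ B)) (trans (cong (_++ reverse A) (unfold-reverse x B)) (++-assoc (reverse B) (x ∷ []) (reverse A)))

module OfW {k n : ℕ} (1≤k : 1 ≤ k) (k<n : k < n) (w : WOG k n) where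
  open WOG w
  open Layout (layout n ys zs vs inc-ys inc-zs inc-vs perm) public

  p : ℕ
  p = n ∸ k

  bar : Bool
  bar = lastBarred w

  k≤n : k ≤ n
  k≤n = <⇒≤ k<n

  1≤n : 1 ≤ n
  1≤n = ≤-trans 1≤k k≤n

  unbarred barred : ℕ → Entry
  unbarred x = (false , x)
  barred   x = (true , x)

  Yw Zw Vw : List Entry
  Yw = map unbarred ys
  Zw = map barred (reverse zs)
  Vw = markLast bar vs

  P : List Entry
  P = toPerm w

  P≡YZ++V : P ≡ (Yw ++ Zw) ++ Vw
  P≡YZ++V = sym (++-assoc Yw Zw Vw)

  length-YZ : length (Yw ++ Zw) ≡ k
  length-YZ = trans (length-++ Yw) (trans (cong₂ _+_ (trans (length-map _ ys) len-ys)
                (trans (length-map _ (reverse zs)) (trans (length-reverse zs) len-zs))) (m∸n+n≡m r≤k))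

  length-V : length Vw ≡ n ∸ k
  length-V = trans (markLast-length bar vs) len-vs

  range-z : ∀ {x} → x ∈ zs → 1 ≤ x × x < 1 + n
  range-z q = ∈-range⁻ 1 n (interleave-∈ˡ ilz q)

  range-y : ∀ {x} → x ∈ ys → 1 ≤ x × x < 1 + n
  range-y q = ∈-range⁻ 1 n (interleave-∈ʳ ilz (interleave-∈ˡ ily q))

  range-v : ∀ {x} → x ∈ vs → 1 ≤ x × x < 1 + n
  range-v q = ∈-range⁻ 1 n (interleave-∈ʳ ilz (interleave-∈ʳ ily q))

  inc-C : Inc C
  inc-C = interleave-incʳ ilz (range-inc 1 n)

  disjoint-yv : ∀ {x} → x ∈ ys → x ∈ vs → ⊥
  disjoint-yv = interleave-disjoint ily inc-C

  disjoint-zv : ∀ {x} → x ∈ zs → x ∈ vs → ⊥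
  disjoint-zv a b = interleave-disjoint ilz (range-inc 1 n) a (interleave-∈ʳ ily b)

  countIf-values : ∀ f → countIf f (range 1 n) ≡ countIf f zs + (countIf f ys + countIf f vs)
  countIf-values f = trans (interleave-countIf f ilz) (cong (countIf f zs +_) (interleave-countIf f ily))

  vs-snoc : Σ (List ℕ) (λ i → Σ ℕ (λ v → vs ≡ i ++ v ∷ []))
  vs-snoc = nonempty-snoc vs (subst (1 ≤_) (sym len-vs) (m<n⇒0<n∸m k<n))

  vinit : List ℕ
  vinit = proj₁ vs-snoc

  vlast : ℕ
  vlast = proj₁ (proj₂ vs-snoc)

  vlast∈vs : vlast ∈ vs
  vlast∈vs = subst (vlast ∈_) (sym (proj₂ (proj₂ vs-snoc))) (∈-++⁺ʳ vinit (here refl))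

  entryAt-last : entryAt P n ≡ (bar , vlast)
  entryAt-last = begin
    entryAt (Yw ++ Zw ++ markLast bar vs) n
      ≡⟨ cong (λ X → entryAt (Yw ++ Zw ++ markLast bar X) n) (proj₂ (proj₂ vs-snoc)) ⟩
    entryAt (Yw ++ Zw ++ markLast bar (vinit ++ vlast ∷ [])) n
      ≡⟨ cong (λ X → entryAt (Yw ++ Zw ++ X) n) (markLast-snoc bar vinit vlast) ⟩
    entryAt (Yw ++ Zw ++ (map unbarred vinit ++ (bar , vlast) ∷ [])) n
      ≡⟨ cong (λ X → entryAt X n) reassoc ⟩
    entryAt (front ++ (bar , vlast) ∷ []) n
      ≡⟨ cong (entryAt (front ++ (bar , vlast) ∷ [])) (sym length-front) ⟩
    entryAt (front ++ (bar , vlast) ∷ []) (suc (length front))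
      ≡⟨ entryAt-middle front (bar , vlast) [] ⟩
    (bar , vlast) ∎
    where
    open ≡-Reasoning
    front = (Yw ++ Zw) ++ map unbarred vinit
    reassoc : Yw ++ Zw ++ (map unbarred vinit ++ (bar , vlast) ∷ []) ≡ front ++ (bar , vlast) ∷ []
    reassoc = trans (sym (++-assoc Yw Zw _)) (sym (++-assoc (Yw ++ Zw) (map unbarred vinit) _))
    length-front : suc (length front) ≡ n
    length-front = begin
      suc (length front)                         ≡⟨ cong suc (length-++ (Yw ++ Zw)) ⟩
      suc (length (Yw ++ Zw) + length (map unbarred vinit))
                                                 ≡⟨ cong₂ (λ a b → suc (a + b)) length-YZ (length-map _ vinit) ⟩
      suc (k + length vinit)                     ≡⟨ sym (+-suc k (length vinit)) ⟩
      k + suc (length vinit)                     ≡⟨ cong (k +_) (trans (+-comm 1 (length vinit)) (sym (length-++ vinit))) ⟩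
      k + length (vinit ++ vlast ∷ [])           ≡⟨ cong (λ X → k + length X) (sym (proj₂ (proj₂ vs-snoc))) ⟩
      k + length vs                              ≡⟨ cong (k +_) len-vs ⟩
      k + (n ∸ k)                                ≡⟨ m+[n∸m]≡n k≤n ⟩
      n                                          ∎

  Row : Set
  Row = ℕ × ℕ × Bool × Bool

  row : ℕ → Row
  row i = ( S1 k n (lam n P) i
          , S1 k n (lam n P) i + S2 k (lam n P) i
          , (S1 k n (lam n P) i ≡ᵇ p) ∧ lam n P (minus (suc k ∸ i) n)
          , (S1 k n (lam n P) i ≡ᵇ p) ∧ lam n P (plus (suc k ∸ i) n) )

  row-shape : ∀ i s m s1 s2 → 1 ≤ suc k ∸ i → suc k ∸ i < n → entryAt P (suc k ∸ i) ≡ (s , m) →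
              S1 k n (lam n P) i ≡ s1 → S2 k (lam n P) i ≡ s2 → ((s1 ≡ᵇ p) ≡ true → vlast < m) →
              row i ≡ (s1 , s1 + s2 , (s1 ≡ᵇ p) ∧ not bar , (s1 ≡ᵇ p) ∧ bar)
  row-shape i s m s1 s2 h1 h2 eA e1 e2 below rewrite e1 | e2
    | lam-minus n P (suc k ∸ i) n h1 h2 ≤-refl | lam-plus n P (suc k ∸ i) n h1 h2 ≤-refl | eA | entryAt-last
    with s1 ≡ᵇ p in full
  ... | false = refl
  ... | true rewrite invMinus-last s m bar vlast (below refl) | invPlus-last s m bar vlast (below refl) = refl

  S1-z : ℕ → ℕ
  S1-z z = p + countIf (z <ᵇ_) vs

  γ-z : ℕ → ℕ
  γ-z z = (n ∸ k) + (n ∸ z)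

  γ-y : ℕ → ℕ
  γ-y y = countLess y vs

  row-z : ℕ → Row
  row-z z = (S1-z z , γ-z z , (S1-z z ≡ᵇ p) ∧ not bar , (S1-z z ≡ᵇ p) ∧ bar)

  row-y : ℕ → Row
  row-y y = (γ-y y , γ-y y , (γ-y y ≡ᵇ p) ∧ not bar , (γ-y y ≡ᵇ p) ∧ bar)

  pairCount-z : ∀ z → z ∈ zs → pairCount (barred z) Vw ≡ S1-z z
  pairCount-z z z∈ = begin
    pairCount (barred z) Vw
      ≡⟨ pairCount-markLast (barred z) (λ v → suc (b2n (z <ᵇ v))) bar vs
           (All.tabulate (λ {v} v∈ s → pairInv-barred z v s (λ e → disjoint-zv z∈ (subst (_∈ vs) e v∈)))) ⟩
    sum (map (λ v → suc (b2n (z <ᵇ v))) vs) ≡⟨ sum-suc-b2n (z <ᵇ_) vs ⟩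
    length vs + countIf (z <ᵇ_) vs          ≡⟨ cong (_+ countIf (z <ᵇ_) vs) len-vs ⟩
    S1-z z ∎
    where open ≡-Reasoning

  pairCount-y : ∀ y → y ∈ ys → pairCount (unbarred y) Vw ≡ γ-y y
  pairCount-y y y∈ = begin
    pairCount (unbarred y) Vw
      ≡⟨ pairCount-markLast (unbarred y) (λ v → b2n (v <ᵇ y)) bar vs
           (All.tabulate (λ {v} v∈ s → pairInv-unbarred y v s (λ e → disjoint-yv y∈ (subst (_∈ vs) e v∈)))) ⟩
    sum (map (λ v → b2n (v <ᵇ y)) vs) ≡⟨ sum-b2n (λ v → v <ᵇ y) vs ⟩
    γ-y y ∎
    where open ≡-Reasoning

  full-z⇒above-last : ∀ z → z ∈ zs → (S1-z z ≡ᵇ p) ≡ true → vlast < z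
  full-z⇒above-last z z∈ e =
    ≤∧≢⇒< (<ᵇ-false⁻ z vlast (lookup none-above vlast∈vs)) (λ eq → disjoint-zv z∈ (subst (_∈ vs) eq vlast∈vs))
    where
    none-above : All (λ v → (z <ᵇ v) ≡ false) vs
    none-above = countIf≡0⇒none (z <ᵇ_) vs (+-cancelˡ-≡ p _ 0 (trans (≡ᵇ-true⁻ _ _ e) (sym (+-identityʳ p))))

  full-y⇒all-below : ∀ y → (γ-y y ≡ᵇ p) ≡ true → All (λ v → (v <ᵇ y) ≡ true) vs
  full-y⇒all-below y e = countIf≡length⇒all (λ v → v <ᵇ y) vs (trans (≡ᵇ-true⁻ _ _ e) (sym len-vs))

  full-y⇒above-last : ∀ y → (γ-y y ≡ᵇ p) ≡ true → vlast < y
  full-y⇒above-last y e = <ᵇ-true⁻ vlast y (lookup (full-y⇒all-below y e) vlast∈vs)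

  -- Row x+1 (x < r) carries z = z_{x+1}, written zs = zpre ++ z ∷ zpost.  Its entry z̄ sits
  -- after the y-block and the barred z's larger than z.

  S2-z : ∀ zpre z zpost → zs ≡ zpre ++ z ∷ zpost →
         countIf (λ e → invPlus e (barred z)) (Yw ++ map barred (reverse zpost)) ≡ countIf (z <ᵇ_) ys + length zpost
  S2-z zpre z zpost ez = begin
    countIf inv-z (Yw ++ map barred (reverse zpost))
      ≡⟨ countIf-++ inv-z Yw _ ⟩
    countIf inv-z Yw + countIf inv-z (map barred (reverse zpost))
      ≡⟨ cong₂ _+_ (sym (countIf-map inv-z unbarred ys)) (sym (countIf-map inv-z barred (reverse zpost))) ⟩
    countIf (λ u → inv-z (unbarred u)) ys + countIf (λ u → inv-z (barred u)) (reverse zpost)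
      ≡⟨ cong₂ _+_ (countIf-cong {l = ys} (All.tabulate (λ {u} _ → invPlus-unbarred-barred u z)))
                   (countIf-reverse (λ u → inv-z (barred u)) zpost) ⟩
    countIf (z <ᵇ_) ys + countIf (λ u → inv-z (barred u)) zpost
      ≡⟨ cong (countIf (z <ᵇ_) ys +_) (countIf-all (All.map (λ {u} h → invPlus-barred-barred u z h) zpost-above)) ⟩
    countIf (z <ᵇ_) ys + length zpost ∎
    where
    open ≡-Reasoning
    inv-z = λ e → invPlus e (barred z)
    zpost-above : All (z <_) zpost
    zpost-above = proj₂ (inc-split zpre (subst Inc ez inc-zs))

  -- S^(1) + S^(2) of that row counts (n-k) plus all values of [1, n] above z.
  part-z : ∀ zpre z zpost → zs ≡ zpre ++ z ∷ zpost → S1-z z + (countIf (z <ᵇ_) ys + length zpost) ≡ γ-z z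
  part-z zpre z zpost ez = begin
    (p + cv) + (cy + length zpost)       ≡⟨ rearrange p cv cy (length zpost) ⟩
    p + (length zpost + (cy + cv))       ≡⟨ cong (λ t → p + (t + (cy + cv))) (sym above-in-zs) ⟩
    p + (countIf (z <ᵇ_) zs + (cy + cv)) ≡⟨ cong (p +_) (sym (countIf-values (z <ᵇ_))) ⟩
    p + countIf (z <ᵇ_) (range 1 n)      ≡⟨ cong (p +_) (countIf-range-above z n) ⟩
    γ-z z ∎
    where
    open ≡-Reasoning
    cv = countIf (z <ᵇ_) vs
    cy = countIf (z <ᵇ_) ys
    rearrange : ∀ a b c d → (a + b) + (c + d) ≡ a + (d + (c + b))
    rearrange = solve-∀
    split = inc-split zpre (subst Inc ez inc-zs)
    above-in-zs : countIf (z <ᵇ_) zs ≡ length zpost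
    above-in-zs = begin
      countIf (z <ᵇ_) zs                                        ≡⟨ cong (countIf (z <ᵇ_)) ez ⟩
      countIf (z <ᵇ_) (zpre ++ z ∷ zpost)                       ≡⟨ countIf-++ (z <ᵇ_) zpre (z ∷ zpost) ⟩
      countIf (z <ᵇ_) zpre + (b2n (z <ᵇ z) + countIf (z <ᵇ_) zpost)
        ≡⟨ cong₂ (λ a b → a + (b2n b + countIf (z <ᵇ_) zpost))
                 (countIf-none (All.map (λ h → <ᵇ-false (<⇒≤ h)) (proj₁ split))) (<ᵇ-false (≤-refl {z})) ⟩
      countIf (z <ᵇ_) zpost                                     ≡⟨ countIf-all (All.map <ᵇ-true (proj₂ split)) ⟩
      length zpost ∎

  P-around-z : ∀ zpre z zpost → zs ≡ zpre ++ z ∷ zpost →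
               P ≡ (Yw ++ map barred (reverse zpost)) ++ barred z ∷ (map barred (reverse zpre) ++ Vw)
  P-around-z zpre z zpost ez = begin
    Yw ++ map barred (reverse zs) ++ Vw
      ≡⟨ cong (λ X → Yw ++ map barred X ++ Vw) (trans (cong reverse ez) (reverse-middle zpre z zpost)) ⟩
    Yw ++ map barred (reverse zpost ++ z ∷ reverse zpre) ++ Vw
      ≡⟨ cong (λ X → Yw ++ X ++ Vw) (map-++ barred (reverse zpost) (z ∷ reverse zpre)) ⟩
    Yw ++ (map barred (reverse zpost) ++ barred z ∷ map barred (reverse zpre)) ++ Vw
      ≡⟨ cong (Yw ++_) (++-assoc (map barred (reverse zpost)) _ Vw) ⟩
    Yw ++ map barred (reverse zpost) ++ barred z ∷ map barred (reverse zpre) ++ Vw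
      ≡⟨ sym (++-assoc Yw (map barred (reverse zpost)) _) ⟩
    (Yw ++ map barred (reverse zpost)) ++ barred z ∷ map barred (reverse zpre) ++ Vw ∎
    where open ≡-Reasoning

  row-at-z : ∀ zpre z zpost → zs ≡ zpre ++ z ∷ zpost → row (1 + length zpre) ≡ row-z z
  row-at-z zpre z zpost ez =
    trans (row-shape (1 + x) true z (S1-z z) s2 (subst (1 ≤_) (sym ea) (s≤s z≤n)) (≤-<-trans a≤k k<n)
             entry e1 e2 (full-z⇒above-last z z∈))
          (cong (λ t → (S1-z z , t , (S1-z z ≡ᵇ p) ∧ not bar , (S1-z z ≡ᵇ p) ∧ bar)) (part-z zpre z zpost ez))
    where
    x = length zpre
    s2 = countIf (z <ᵇ_) ys + length zpost
    pre post : List Entry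
    pre  = Yw ++ map barred (reverse zpost)
    post = map barred (reverse zpre) ++ Vw
    z∈ : z ∈ zs
    z∈ = subst (z ∈_) (sym ez) (∈-++⁺ʳ zpre (here refl))
    P≡ : P ≡ pre ++ barred z ∷ post
    P≡ = P-around-z zpre z zpost ez
    k≡ : k ≡ (k ∸ r) + (x + suc (length zpost))
    k≡ = trans (sym (m∸n+n≡m r≤k)) (cong ((k ∸ r) +_) (trans (sym len-zs) (trans (cong length ez) (length-++ zpre))))
    length-pre : length pre ≡ (k ∸ r) + length zpost
    length-pre = trans (length-++ Yw) (cong₂ _+_ (trans (length-map _ ys) len-ys)
                   (trans (length-map barred (reverse zpost)) (length-reverse zpost)))
    ea : suc k ∸ (1 + x) ≡ suc (length pre)
    ea = trans (cong (_∸ x) k≡) (trans (position-z (k ∸ r) x (length zpost)) (cong suc (sym length-pre)))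
    eb : k ∸ (1 + x) ≡ length pre
    eb = trans (cong (_∸ suc x) k≡) (trans (position-z′ (k ∸ r) x (length zpost)) (sym length-pre))
    a≤k : suc k ∸ (1 + x) ≤ k
    a≤k = m∸n≤m k x
    entry : entryAt P (suc k ∸ (1 + x)) ≡ barred z
    entry = trans (cong₂ entryAt P≡ ea) (entryAt-middle pre (barred z) post)
    e1 : S1 k n (lam n P) (1 + x) ≡ S1-z z
    e1 = trans (cong (λ Q → S1 k n (lam n Q) (1 + x)) P≡YZ++V)
           (trans (S1-pairCount n k (1 + x) (Yw ++ Zw) Vw (suc k ∸ (1 + x)) (barred z) length-YZ length-V k≤n refl
                    (subst (1 ≤_) (sym ea) (s≤s z≤n)) a≤k
                    (trans (cong (λ Q → entryAt Q (suc k ∸ (1 + x))) (sym P≡YZ++V)) entry))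
                  (pairCount-z z z∈))
    e2 : S2 k (lam n P) (1 + x) ≡ s2
    e2 = trans (cong (λ Q → S2 k (lam n Q) (1 + x)) P≡)
           (trans (S2-prefix n k (1 + x) pre post (barred z) ea eb (subst (_≤ n) ea (≤-trans a≤k k≤n)))
                  (S2-z zpre z zpost ez))

  P-around-y : ∀ ypre y ypost → ys ≡ ypre ++ y ∷ ypost →
               P ≡ map unbarred ypre ++ unbarred y ∷ (map unbarred ypost ++ Zw ++ Vw)
  P-around-y ypre y ypost ys≡ = begin
    map unbarred ys ++ Zw ++ Vw
      ≡⟨ cong (λ X → map unbarred X ++ Zw ++ Vw) ys≡ ⟩
    map unbarred (ypre ++ y ∷ ypost) ++ Zw ++ Vw
      ≡⟨ cong (_++ Zw ++ Vw) (map-++ unbarred ypre (y ∷ ypost)) ⟩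
    (map unbarred ypre ++ unbarred y ∷ map unbarred ypost) ++ Zw ++ Vw
      ≡⟨ ++-assoc (map unbarred ypre) _ _ ⟩
    map unbarred ypre ++ unbarred y ∷ (map unbarred ypost ++ Zw ++ Vw) ∎
    where open ≡-Reasoning

  -- Row r+x+1 carries y = y_{k-r-x}, written reverse ys = rpre ++ y ∷ rpost; no root
  -- e_c + e_a with c before it is an inversion, so S^(2) = 0.
  row-at-y : ∀ rpre y rpost → reverse ys ≡ rpre ++ y ∷ rpost → row ((1 + r) + length rpre) ≡ row-y y
  row-at-y rpre y rpost e =
    trans (row-shape i false y (γ-y y) 0 (subst (1 ≤_) (sym ea) (s≤s z≤n)) (≤-<-trans a≤k k<n)
             entry e1 e2 (full-y⇒above-last y))
          (cong (λ t → (γ-y y , t , (γ-y y ≡ᵇ p) ∧ not bar , (γ-y y ≡ᵇ p) ∧ bar)) (+-identityʳ (γ-y y)))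
    where
    x = length rpre
    i = (1 + r) + x
    pre post : List Entry
    pre  = map unbarred (reverse rpost)
    post = map unbarred (reverse rpre) ++ Zw ++ Vw
    ys≡ : ys ≡ reverse rpost ++ y ∷ reverse rpre
    ys≡ = trans (sym (reverse-involutive ys)) (trans (cong reverse e) (reverse-middle rpre y rpost))
    y∈ : y ∈ ys
    y∈ = subst (y ∈_) (sym ys≡) (∈-++⁺ʳ (reverse rpost) (here refl))
    P≡ : P ≡ pre ++ unbarred y ∷ post
    P≡ = P-around-y (reverse rpost) y (reverse rpre) ys≡
    k≡ : k ≡ (x + suc (length rpost)) + r
    k≡ = trans (sym (m∸n+n≡m r≤k)) (cong (_+ r)
           (trans (sym len-ys) (trans (sym (length-reverse ys)) (trans (cong length e) (length-++ rpre)))))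
    length-pre : length pre ≡ length rpost
    length-pre = trans (length-map unbarred (reverse rpost)) (length-reverse rpost)
    ea : suc k ∸ i ≡ suc (length pre)
    ea = trans (cong (_∸ (r + x)) k≡) (trans (position-y x (length rpost) r) (cong suc (sym length-pre)))
    eb : k ∸ i ≡ length pre
    eb = trans (cong (_∸ suc (r + x)) k≡) (trans (position-y′ x (length rpost) r) (sym length-pre))
    a≤k : suc k ∸ i ≤ k
    a≤k = m∸n≤m k (r + x)
    entry : entryAt P (suc k ∸ i) ≡ unbarred y
    entry = trans (cong₂ entryAt P≡ ea) (entryAt-middle pre (unbarred y) post)
    e1 : S1 k n (lam n P) i ≡ γ-y y
    e1 = trans (cong (λ Q → S1 k n (lam n Q) i) P≡YZ++V)
           (trans (S1-pairCount n k i (Yw ++ Zw) Vw (suc k ∸ i) (unbarred y) length-YZ length-V k≤n refl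
                    (subst (1 ≤_) (sym ea) (s≤s z≤n)) a≤k
                    (trans (cong (λ Q → entryAt Q (suc k ∸ i)) (sym P≡YZ++V)) entry))
                  (pairCount-y y y∈))
    e2 : S2 k (lam n P) i ≡ 0
    e2 = trans (cong (λ Q → S2 k (lam n Q) i) P≡)
           (trans (S2-prefix n k i pre post (unbarred y) ea eb (subst (_≤ n) ea (≤-trans a≤k k≤n)))
             (trans (sym (countIf-map (λ e′ → invPlus e′ (unbarred y)) unbarred (reverse rpost)))
                    (countIf-none (All.map (λ {u} h → invPlus-unbarred-unbarred u y h)
                                           (proj₁ (inc-split (reverse rpost) (subst Inc ys≡ inc-ys)))))))

  rows : map row (between 1 k) ≡ map row-z zs ++ map row-y (reverse ys)
  rows = begin
    map row (between 1 k)
      ≡⟨ cong (map row) (trans (between-range 1 k) (trans (cong (range 1) (trans (sym (m∸n+n≡m r≤k)) (+-comm (k ∸ r) r)))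
                                                          (range-++ 1 r (k ∸ r)))) ⟩
    map row (range 1 r ++ range (1 + r) (k ∸ r))
      ≡⟨ map-++ row (range 1 r) _ ⟩
    map row (range 1 r) ++ map row (range (1 + r) (k ∸ r))
      ≡⟨ cong₂ _++_ (trans (cong (λ m → map row (range 1 m)) (sym len-zs)) (map-range-by-elements zs 1 row row-z row-at-z))
                    (trans (cong (λ m → map row (range (1 + r) m)) (trans (sym len-ys) (sym (length-reverse ys))))
                           (map-range-by-elements (reverse ys) (1 + r) row row-y row-at-y)) ⟩
    map row-z zs ++ map row-y (reverse ys) ∎
    where open ≡-Reasoning

  map-rows : {B : Set} (f : Row → B) →
             map (λ i → f (row i)) (between 1 k) ≡ map (λ z → f (row-z z)) zs ++ map (λ y → f (row-y y)) (reverse ys)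
  map-rows f = trans (map-∘ (between 1 k)) (trans (cong (map f) rows)
                 (trans (map-++ f (map row-z zs) _) (cong₂ _++_ (sym (map-∘ zs)) (sym (map-∘ (reverse ys))))))

  full : List Bool
  full = map (λ z → S1-z z ≡ᵇ p) zs ++ map (λ y → γ-y y ≡ᵇ p) (reverse ys)

  γ : List ℕ
  γ = map γ-z zs ++ map γ-y (reverse ys)

  γ-y≤p : ∀ y → γ-y y ≤ p
  γ-y≤p y = subst (γ-y y ≤_) len-vs (countIf≤length (λ v → v <ᵇ y) vs)

  full-y⇒n∉vs : ∀ y → y ∈ ys → (γ-y y ≡ᵇ p) ≡ true → ¬ (n ∈ vs)
  full-y⇒n∉vs y y∈ e n∈ = <⇒≱ (<ᵇ-true⁻ n y (lookup (full-y⇒all-below y e) n∈)) (≤-pred (proj₂ (range-y y∈)))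

  n≤z⇒n∉vs : ∀ z → z ∈ zs → n ≤ z → ¬ (n ∈ vs)
  n≤z⇒n∉vs z z∈ n≤z n∈ = disjoint-zv z∈ (subst (_∈ vs) (≤-antisym n≤z (≤-pred (proj₂ (range-z z∈)))) n∈)

  full⇒n∉vs : true ∈ full → ¬ (n ∈ vs)
  full⇒n∉vs t∈ with ∈-++⁻ (map (λ z → S1-z z ≡ᵇ p) zs) t∈
  ... | inj₁ q with ∈-map⁻ (λ z → S1-z z ≡ᵇ p) q
  ...   | z , z∈ , e = λ n∈ → n≤z⇒n∉vs z z∈ (n≤z n∈) n∈
    where
    n≤z : n ∈ vs → n ≤ z
    n≤z n∈ = <ᵇ-false⁻ z n (lookup (countIf≡0⇒none (z <ᵇ_) vs
               (+-cancelˡ-≡ p _ 0 (trans (≡ᵇ-true⁻ _ _ (sym e)) (sym (+-identityʳ p))))) n∈)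
  full⇒n∉vs t∈ | inj₂ q with ∈-map⁻ (λ y → γ-y y ≡ᵇ p) q
  ...   | y , y∈ , e = full-y⇒n∉vs y (AnyP.reverse⁻ y∈) (sym e)

  p∈γ⇒n∉vs : p ∈ γ → ¬ (n ∈ vs)
  p∈γ⇒n∉vs p∈ with ∈-++⁻ (map γ-z zs) p∈
  ... | inj₁ q with ∈-map⁻ γ-z q
  ...   | z , z∈ , e = n≤z⇒n∉vs z z∈ (m∸n≡0⇒m≤n (+-cancelˡ-≡ p _ 0 (trans (sym e) (sym (+-identityʳ p)))))
  p∈γ⇒n∉vs p∈ | inj₂ q with ∈-map⁻ γ-y q
  ...   | y , y∈ , e = full-y⇒n∉vs y (AnyP.reverse⁻ y∈) (subst (λ t → (t ≡ᵇ p) ≡ true) e (≡ᵇ-refl p))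

  n∉vs⇒full×p∈γ : ¬ (n ∈ vs) → true ∈ full × p ∈ γ
  n∉vs⇒full×p∈γ n∉ with interleave-∈⁻ ilz (∈-range⁺ 1 n 1≤n ≤-refl)
  ... | inj₁ n∈zs = ∈-++⁺ˡ (at n∈zs S1-n≡p) , ∈-++⁺ˡ (subst (_∈ map γ-z zs) γ-n≡p (∈-map⁺ γ-z n∈zs))
    where
    at : ∀ {z} → z ∈ zs → (S1-z z ≡ᵇ p) ≡ true → true ∈ map (λ z → S1-z z ≡ᵇ p) zs
    at z∈ e = subst (_∈ map (λ z → S1-z z ≡ᵇ p) zs) e (∈-map⁺ (λ z → S1-z z ≡ᵇ p) z∈)
    S1-n≡p : (S1-z n ≡ᵇ p) ≡ true
    S1-n≡p = subst (λ t → ((p + t) ≡ᵇ p) ≡ true)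
               (sym (countIf-none (All.tabulate (λ v∈ → <ᵇ-false (≤-pred (proj₂ (range-v v∈)))))))
               (subst (λ t → (t ≡ᵇ p) ≡ true) (sym (+-identityʳ p)) (≡ᵇ-refl p))
    γ-n≡p : γ-z n ≡ p
    γ-n≡p = trans (cong (p +_) (n∸n≡0 n)) (+-identityʳ p)
  ... | inj₂ n∈C with interleave-∈⁻ ily n∈C
  ...   | inj₂ n∈vs = ⊥-elim (n∉ n∈vs)
  ...   | inj₁ n∈ys = ∈-++⁺ʳ (map (λ z → S1-z z ≡ᵇ p) zs) (subst (_∈ map (λ y → γ-y y ≡ᵇ p) (reverse ys)) γ-n≡p′ (∈-map⁺ (λ y → γ-y y ≡ᵇ p) n∈rys))
                    , ∈-++⁺ʳ (map γ-z zs) (subst (_∈ map γ-y (reverse ys)) γ-n≡p (∈-map⁺ γ-y n∈rys))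
    where
    n∈rys : n ∈ reverse ys
    n∈rys = AnyP.reverse⁺ n∈ys
    γ-n≡p : γ-y n ≡ p
    γ-n≡p = trans (countIf-all (All.tabulate (λ {v} v∈ →
              <ᵇ-true (≤∧≢⇒< (≤-pred (proj₂ (range-v v∈))) (λ eq → n∉ (subst (_∈ vs) eq v∈)))))) len-vs
    γ-n≡p′ : (γ-y n ≡ᵇ p) ≡ true
    γ-n≡p′ = subst (λ t → (t ≡ᵇ p) ≡ true) (sym γ-n≡p) (≡ᵇ-refl p)

  full≡p∈γ : or full ≡ any (_≡ᵇ p) γ
  full≡p∈γ = bool-ext (λ e → any-≡ᵇ⁺ p γ (proj₂ (n∉vs⇒full×p∈γ (full⇒n∉vs (or⁻ full e)))))
                      (λ e → or⁺ full (proj₁ (n∉vs⇒full×p∈γ (p∈γ⇒n∉vs (any-≡ᵇ⁻ p γ e)))))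

  assignedUp≡ : assignedUp k n (lam n P) ≡ or full ∧ not bar
  assignedUp≡ = trans (cong or (trans (map-rows (λ q → proj₁ (proj₂ (proj₂ q)))) (sym flags)))
                      (or-∧ full (not bar))
    where
    flags : map (_∧ not bar) full ≡ map (λ z → (S1-z z ≡ᵇ p) ∧ not bar) zs ++ map (λ y → (γ-y y ≡ᵇ p) ∧ not bar) (reverse ys)
    flags = trans (map-++ (_∧ not bar) (map (λ z → S1-z z ≡ᵇ p) zs) _) (cong₂ _++_ (sym (map-∘ zs)) (sym (map-∘ (reverse ys))))

  assignedDown≡ : assignedDown k n (lam n P) ≡ or full ∧ bar
  assignedDown≡ = trans (cong or (trans (map-rows (λ q → proj₂ (proj₂ (proj₂ q)))) (sym flags)))
                        (or-∧ full bar)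
    where
    flags : map (_∧ bar) full ≡ map (λ z → (S1-z z ≡ᵇ p) ∧ bar) zs ++ map (λ y → (γ-y y ≡ᵇ p) ∧ bar) (reverse ys)
    flags = trans (map-++ (_∧ bar) (map (λ z → S1-z z ≡ᵇ p) zs) _) (cong₂ _++_ (sym (map-∘ zs)) (sym (map-∘ (reverse ys))))

  Fk-lam≡gammaTilde : Fk k n (lam n P) ≡ gammaTilde w
  Fk-lam≡gammaTilde = cong₂ _,_ (map-rows (λ q → proj₁ (proj₂ q))) flag
    where
    decide : ∀ (a b : Bool) → (if a ∧ not b then 1 else (if a ∧ b then 2 else 0)) ≡ (if a then (if not b then 1 else 2) else 0)
    decide false b     = refl
    decide true  false = refl
    decide true  true  = refl
    flag : (if assignedUp k n (lam n P) then 1 else (if assignedDown k n (lam n P) then 2 else 0))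
         ≡ (if any (_≡ᵇ p) γ then (if typeI w then 1 else 2) else 0)
    flag rewrite assignedUp≡ | assignedDown≡ | full≡p∈γ = decide (any (_≡ᵇ p) γ) bar

  length-γ : length γ ≡ k
  length-γ = trans (length-++ (map γ-z zs)) (trans (cong₂ _+_ (trans (length-map γ-z zs) len-zs)
               (trans (length-map γ-y (reverse ys)) (trans (length-reverse ys) len-ys))) (trans (+-comm r (k ∸ r)) (m∸n+n≡m r≤k)))

  -- The z-parts are > n-k and strictly decreasing, the y-parts are ≤ n-k and weakly decreasing.
  chain-z : ∀ {xs} → Inc xs → All (_≤ n) xs → Linked (StrictStep p) (map γ-z xs)
  chain-z []       _            = []
  chain-z [-]      _            = [-]
  chain-z (r′ ∷ rs) (_ ∷ b ∷ bs) = (<⇒≤ lt , λ _ → lt) ∷ chain-z rs (b ∷ bs)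
    where lt = +-monoʳ-< p (∸-monoʳ-< r′ b)

  chain-y : ∀ {xs} → Linked (λ a b → b < a) xs → Linked (StrictStep p) (map γ-y xs)
  chain-y []  = []
  chain-y [-] = [-]
  chain-y {x ∷ x′ ∷ xs} (r′ ∷ rs) =
    ( countIf-mono (λ v → v <ᵇ x′) (λ v → v <ᵇ x) vs (λ v e → <ᵇ-true (<-trans (<ᵇ-true⁻ v x′ e) r′))
    , λ h → ⊥-elim (<⇒≱ h (γ-y≤p x)) ) ∷ chain-y rs

  chain-γ : Linked (StrictStep p) γ
  chain-γ = linked-++ {P = p ≤_} {Q = _≤ p}
    (chain-z inc-zs (All.tabulate (λ z∈ → ≤-pred (proj₂ (range-z z∈)))))
    (chain-y (linked-reverse <-trans inc-ys))
    (All.tabulate (λ {x} x∈ → let (z , _ , e) = ∈-map⁻ γ-z x∈ in subst (p ≤_) (sym e) (m≤m+n p (n ∸ z))))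
    (All.tabulate (λ {x} x∈ → let (y , _ , e) = ∈-map⁻ γ-y x∈ in subst (_≤ p) (sym e) (γ-y≤p y)))
    (λ px qy → ≤-trans qy px , λ h → ≤-<-trans qy h)

  -- Every part is at most (n-k) + (n-1) = 2n-1-k.
  bounded-γ : All (_≤ 2 * n ∸ 1 ∸ k) γ
  bounded-γ = All.tabulate (λ {x} x∈ → bound x (∈-++⁻ (map γ-z zs) x∈))
    where
    bound : ∀ x → (x ∈ map γ-z zs) ⊎ (x ∈ map γ-y (reverse ys)) → x ≤ 2 * n ∸ 1 ∸ k
    bound x (inj₁ q) with ∈-map⁻ γ-z q
    ... | z , z∈ , refl = subst (γ-z z ≤_) (bound-split n k 1≤n k≤n) (+-monoʳ-≤ p (∸-monoʳ-≤ n (proj₁ (range-z z∈))))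
    bound x (inj₂ q) with ∈-map⁻ γ-y q
    ... | y , y∈ , refl = subst (γ-y y ≤_) (bound-split n k 1≤n k≤n) (≤-trans (γ-y≤p y) (m≤m+n p (n ∸ 1)))

  tag-γ : (¬ (p ∈ γ) × proj₂ (gammaTilde w) ≡ 0) ⊎ (p ∈ γ × (proj₂ (gammaTilde w) ≡ 1 ⊎ proj₂ (gammaTilde w) ≡ 2))
  tag-γ with any (_≡ᵇ p) γ in has-p
  ... | false = inj₁ ((λ p∈ → false≢true (trans (sym has-p) (any-≡ᵇ⁺ p γ p∈))) , refl)
    where
    false≢true : false ≡ true → ⊥
    false≢true ()
  ... | true  = inj₂ (any-≡ᵇ⁻ p γ has-p , one-or-two (typeI w))
    where
    one-or-two : ∀ b → (if b then 1 else 2) ≡ 1 ⊎ (if b then 1 else 2) ≡ 2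
    one-or-two true  = inj₁ refl
    one-or-two false = inj₂ refl

  gammaTilde∈Ptilde : InPtilde k n (gammaTilde w)
  gammaTilde∈Ptilde = length-γ , chain-γ , bounded-γ , tag-γ

prefix-of-map : ∀ {A B : Set} (f : A → B) (X X′ : List A) (Y Y′ : List B) →
  map f X ++ Y ≡ map f X′ ++ Y′ → length X ≤ length X′ →
  Σ (List A) (λ X₁ → Σ (List A) (λ X₂ → (X′ ≡ X₁ ++ X₂) × (map f X₁ ≡ map f X) × (Y ≡ map f X₂ ++ Y′)))
prefix-of-map f []      X′       Y Y′ e _ = [] , X′ , refl , refl , e
prefix-of-map f (x ∷ X) (x′ ∷ X′) Y Y′ e (s≤s le) with prefix-of-map f X X′ Y Y′ (∷-injectiveʳ e) le
... | X₁ , X₂ , e₁ , e₂ , e₃ = x′ ∷ X₁ , X₂ , cong (x′ ∷_) e₁ , cong₂ _∷_ (sym (∷-injectiveˡ e)) e₂ , e₃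

odd-suc : ∀ r → odd (r + 1) ≡ not (odd r)
odd-suc r = cong odd (+-comm r 1)

not-fixed : ∀ b → b ≡ not b → ⊥
not-fixed true  ()
not-fixed false ()

tag-injective : ∀ a b → (if not a then 1 else 2) ≡ (if not b then 1 else 2) → a ≡ b
tag-injective false false _ = refl
tag-injective true  true  _ = refl
tag-injective false true  ()
tag-injective true  false ()

z-parts-injective : ∀ n p (xs ys : List ℕ) → All (_≤ n) xs → All (_≤ n) ys →
  map (λ z → p + (n ∸ z)) xs ≡ map (λ z → p + (n ∸ z)) ys → xs ≡ ys
z-parts-injective n p []       []       _        _        _ = refl
z-parts-injective n p (x ∷ xs) (y ∷ ys) (a ∷ as) (b ∷ bs) e =
  cong₂ _∷_ (∸-cancelˡ-≡ a b (+-cancelˡ-≡ p (n ∸ x) (n ∸ y) (∷-injectiveˡ e))) (z-parts-injective n p xs ys as bs (∷-injectiveʳ e))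

countLess-cons : ∀ c y vs → c < y → countLess y (c ∷ vs) ≡ suc (countLess y vs)
countLess-cons c y vs lt rewrite <ᵇ-true lt = refl

map-suc-injective : ∀ {A : Set} (f g : A → ℕ) xs ys → map (λ x → suc (f x)) xs ≡ map (λ x → suc (g x)) ys → map f xs ≡ map g ys
map-suc-injective f g []       []       e = refl
map-suc-injective f g (x ∷ xs) (y ∷ ys) e =
  cong₂ _∷_ (suc-injective (∷-injectiveˡ e)) (map-suc-injective f g xs ys (∷-injectiveʳ e))

split-by-counts-unique : ∀ {C ys vs ys′ vs′} → Inc C → Interleave ys vs C → Interleave ys′ vs′ C →
  map (λ y → countLess y vs) ys ≡ map (λ y → countLess y vs′) ys′ → (ys ≡ ys′) × (vs ≡ vs′)
split-by-counts-unique i [] [] e = refl , refl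
split-by-counts-unique i (l∷ c il) (l∷ .c il′) e with split-by-counts-unique (Linked.tail i) il il′ (∷-injectiveʳ e)
... | refl , refl = refl , refl
split-by-counts-unique {vs = .c ∷ vs₁} {ys′ = ys′} {vs′ = .c ∷ vs₁′} i (r∷ c {A = ys} il) (r∷ .c il′) e
  with split-by-counts-unique (Linked.tail i) il il′
         (map-suc-injective (λ y → countLess y vs₁) (λ y → countLess y vs₁′) ys ys′
           (trans (map-cong-local (All.map (λ {y} lt → sym (countLess-cons c y vs₁ lt)) (interleave-Allˡ il (inc-head i))))
             (trans e (map-cong-local (All.map (λ {y} lt → countLess-cons c y vs₁′ lt) (interleave-Allˡ il′ (inc-head i)))))))
... | refl , refl = refl , refl
split-by-counts-unique {ys′ = []} i (l∷ c il) (r∷ .c il′) ()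
split-by-counts-unique {vs = vs} {ys′ = y′ ∷ ys′} {vs′ = .c ∷ vs₁′} i (l∷ c il) (r∷ .c il′) e =
  ⊥-elim (0≢1+n (trans (sym none-below) (trans (∷-injectiveˡ e)
    (countLess-cons c y′ vs₁′ (lookup (interleave-Allˡ il′ (inc-head i)) (here refl))))))
  where
  none-below : countLess c vs ≡ 0
  none-below = countIf-none (All.map (λ lt → <ᵇ-false (<⇒≤ lt)) (interleave-Allʳ il (inc-head i)))
split-by-counts-unique {ys = []} i (r∷ c il) (l∷ .c il′) ()
split-by-counts-unique {ys = y ∷ ys} {vs = .c ∷ vs₁} {vs′ = vs′} i (r∷ c il) (l∷ .c il′) e =
  ⊥-elim (0≢1+n (trans (sym none-below) (trans (sym (∷-injectiveˡ e))
    (countLess-cons c y vs₁ (lookup (interleave-Allˡ il (inc-head i)) (here refl))))))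
  where
  none-below : countLess c vs′ ≡ 0
  none-below = countIf-none (All.map (λ lt → <ᵇ-false (<⇒≤ lt)) (interleave-Allʳ il′ (inc-head i)))

module Compare {k n : ℕ} (1≤k : 1 ≤ k) (k<n : k < n) (w w′ : WOG k n) (same : gammaTilde w ≡ gammaTilde w′) where
  module A = OfW 1≤k k<n w
  module B = OfW 1≤k k<n w′
  open WOG

  p : ℕ
  p = n ∸ k

  γ-z : ℕ → ℕ
  γ-z = A.γ-z

  prefix : r w ≤ r w′ →
    Σ (List ℕ) (λ X₁ → Σ (List ℕ) (λ X₂ → (zs w′ ≡ X₁ ++ X₂) × (map γ-z X₁ ≡ map γ-z (zs w))
      × (map A.γ-y (reverse (ys w)) ≡ map γ-z X₂ ++ map B.γ-y (reverse (ys w′)))))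
  prefix le = prefix-of-map γ-z (zs w) (zs w′) _ _ (cong proj₁ same)
                (subst₂ _≤_ (sym (len-zs w)) (sym (len-zs w′)) le)

  z-part≤p⇒n≤z : ∀ z → γ-z z ≤ p → n ≤ z
  z-part≤p⇒n≤z z le = m∸n≡0⇒m≤n (n≤0⇒n≡0 (+-cancelˡ-≤ p (n ∸ z) 0 (subst (γ-z z ≤_) (sym (+-identityʳ p)) le)))

  same-parity : p ∈ A.γ → odd (r w) ≡ odd (r w′)
  same-parity p∈ = tag-injective (odd (r w)) (odd (r w′))
    (trans (sym (tag-of w (any-≡ᵇ⁺ p A.γ p∈))) (trans (cong proj₂ same) (tag-of w′ (any-≡ᵇ⁺ p B.γ p∈′))))
    where
    p∈′ : p ∈ B.γ
    p∈′ = subst (p ∈_) (cong proj₁ same) p∈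
    tag-of : ∀ (u : WOG k n) → any (_≡ᵇ p) (proj₁ (gammaTilde u)) ≡ true → proj₂ (gammaTilde u) ≡ (if typeI u then 1 else 2)
    tag-of u has rewrite has = refl

  -- w′ cannot have more barred entries than w: the first extra z̄ of w′ would give a
  -- z-part equal to a y-part of w, hence z = n, the largest z of w′ and its only extra one,
  -- so the numbers of bars of w and w′ would differ by one although the types agree.
  r-not-less : r w < r w′ → ⊥
  r-not-less lt with prefix (<⇒≤ lt)
  ... | X₁ , X₂ , zs′≡ , m₁ , e₂ = extra X₂ refl
    where
    length-X₁ : length X₁ ≡ r w
    length-X₁ = trans (sym (length-map γ-z X₁)) (trans (cong length m₁) (trans (length-map γ-z (zs w)) (len-zs w)))
    r′≡ : r w′ ≡ r w + length X₂
    r′≡ = trans (sym (len-zs w′)) (trans (cong length zs′≡) (trans (length-++ X₁) (cong (_+ length X₂) length-X₁)))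
    extra : ∀ X → X ≡ X₂ → ⊥
    extra [] refl = <-irrefl (sym (trans r′≡ (+-identityʳ _))) lt
    extra (z₁ ∷ X′) refl = last-extra X′ refl
      where
      z₁-part∈ : γ-z z₁ ∈ map A.γ-y (reverse (ys w))
      z₁-part∈ = subst (γ-z z₁ ∈_) (sym e₂) (here refl)
      n≤z₁ : n ≤ z₁
      n≤z₁ with ∈-map⁻ A.γ-y z₁-part∈
      ... | y , _ , e = z-part≤p⇒n≤z z₁ (subst (_≤ p) (sym e) (A.γ-y≤p y))
      last-extra : ∀ X → X ≡ X′ → ⊥
      last-extra (z₂ ∷ _) refl =
        <⇒≱ (≤-<-trans n≤z₁ (lookup (proj₂ (inc-split X₁ (subst Inc zs′≡ (inc-zs w′)))) (here refl)))
             (≤-pred (proj₂ (B.range-z (subst (z₂ ∈_) (sym zs′≡) (∈-++⁺ʳ X₁ (there (here refl)))))))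
      last-extra [] refl = not-fixed (odd (r w)) (trans (same-parity p∈γ) (trans (cong odd r′≡) (odd-suc (r w))))
        where
        z₁-part≡p : γ-z z₁ ≡ p
        z₁-part≡p = trans (cong (p +_) (m≤n⇒m∸n≡0 n≤z₁)) (+-identityʳ p)
        p∈γ : p ∈ A.γ
        p∈γ = subst (_∈ A.γ) z₁-part≡p (∈-++⁺ʳ (map γ-z (zs w)) z₁-part∈)

  -- With equal numbers of bars, the z's agree, hence so do their complements C, and
  -- the y's and v's are recovered from the counts γ-y.
  blocks-equal : r w ≡ r w′ → (ys w ≡ ys w′) × (zs w ≡ zs w′) × (vs w ≡ vs w′)
  blocks-equal r≡ with prefix (≤-reflexive r≡)
  ... | X₁ , X₂ , zs′≡ , m₁ , e₂ = proj₁ ys-vs , zs≡ , proj₂ ys-vs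
    where
    X₂≡[] : X₂ ≡ []
    X₂≡[] = length-0 X₂ (+-cancelˡ-≡ (r w) (length X₂) 0 (begin
      r w + length X₂        ≡⟨ cong (_+ length X₂) (sym (trans (sym (length-map γ-z X₁)) (trans (cong length m₁)
                                  (trans (length-map γ-z (zs w)) (len-zs w))))) ⟩
      length X₁ + length X₂  ≡⟨ sym (length-++ X₁) ⟩
      length (X₁ ++ X₂)      ≡⟨ cong length (sym zs′≡) ⟩
      length (zs w′)         ≡⟨ len-zs w′ ⟩
      r w′                   ≡⟨ sym r≡ ⟩
      r w                    ≡⟨ sym (+-identityʳ (r w)) ⟩
      r w + 0                ∎))
      where
      open ≡-Reasoning
      length-0 : ∀ (X : List ℕ) → length X ≡ 0 → X ≡ []
      length-0 [] _ = refl
    zs≡ : zs w ≡ zs w′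
    zs≡ = z-parts-injective n p (zs w) (zs w′) (bounded A.range-z) (bounded B.range-z)
            (sym (trans (cong (map γ-z) (trans zs′≡ (trans (cong (X₁ ++_) X₂≡[]) (++-identityʳ X₁)))) m₁))
      where
      bounded : ∀ {xs} → (∀ {x} → x ∈ xs → 1 ≤ x × x < 1 + n) → All (_≤ n) xs
      bounded range-xs = All.tabulate (λ x∈ → ≤-pred (proj₂ (range-xs x∈)))
    C≡ : B.C ≡ A.C
    C≡ = interleave-unique (range-inc 1 n) (subst (λ Z → Interleave Z B.C (range 1 n)) (sym zs≡) B.ilz) A.ilz
    y-counts : map A.γ-y (ys w) ≡ map B.γ-y (ys w′)
    y-counts = reverse-injective (trans (sym (reverse-map A.γ-y (ys w)))
                 (trans (trans e₂ (cong (λ X → map γ-z X ++ _) X₂≡[])) (reverse-map B.γ-y (ys w′))))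
    ys-vs : (ys w ≡ ys w′) × (vs w ≡ vs w′)
    ys-vs = split-by-counts-unique A.inc-C A.ily (subst (Interleave (ys w′) (vs w′)) C≡ B.ily) y-counts

toPerm-cong : ∀ {k n} (w w′ : WOG k n) → WOG.ys w ≡ WOG.ys w′ → WOG.zs w ≡ WOG.zs w′ → WOG.vs w ≡ WOG.vs w′ →
              WOG.r w ≡ WOG.r w′ → toPerm w ≡ toPerm w′
toPerm-cong w w′ ys≡ zs≡ vs≡ r≡ =
  cong₂ _++_ (cong (map (false ,_)) ys≡)
    (cong₂ _++_ (cong (λ Z → map (true ,_) (reverse Z)) zs≡) (cong₂ markLast (cong odd r≡) vs≡))

same-r : ∀ {k n} (1≤k : 1 ≤ k) (k<n : k < n) (w w′ : WOG k n) → gammaTilde w ≡ gammaTilde w′ → WOG.r w ≡ WOG.r w′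
same-r 1≤k k<n w w′ same with <-cmp (WOG.r w) (WOG.r w′)
... | tri< lt _ _ = ⊥-elim (Compare.r-not-less 1≤k k<n w w′ same lt)
... | tri≈ _ eq _ = eq
... | tri> _ _ gt = ⊥-elim (Compare.r-not-less 1≤k k<n w′ w (sym same) gt)

gammaTilde-injective : ∀ {k n} (1≤k : 1 ≤ k) (k<n : k < n) (w w′ : WOG k n) →
                       gammaTilde w ≡ gammaTilde w′ → toPerm w ≡ toPerm w′
gammaTilde-injective 1≤k k<n w w′ same =
  let r≡ = same-r 1≤k k<n w w′ same
      (ys≡ , zs≡ , vs≡) = Compare.blocks-equal 1≤k k<n w w′ same r≡
  in toPerm-cong w w′ ys≡ zs≡ vs≡ r≡

SplitByCounts : List ℕ → List ℕ → Set
SplitByCounts C cs = Σ (List ℕ) (λ ys → Σ (List ℕ) (λ vs →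
  Interleave ys vs C × (map (λ y → countLess y vs) ys ≡ cs) × (length vs ≡ length C ∸ length cs)))

map-suc-pred : ∀ (cs : List ℕ) → All (1 ≤_) cs → map suc (map pred cs) ≡ cs
map-suc-pred []           []       = refl
map-suc-pred (suc x ∷ cs) (_ ∷ ps) = cong (suc x ∷_) (map-suc-pred cs ps)

-- Scanning C from below: a zero count makes the current element a y; otherwise it is a v,
-- and all remaining counts drop by one.
mutual
  split-by-counts : ∀ C cs → Inc C → Linked _≤_ cs → length cs ≤ length C →
                    All (_≤ length C ∸ length cs) cs → SplitByCounts C cs
  split-by-counts []      []           iC lc le bd = [] , [] , [] , refl , refl
  split-by-counts (c ∷ C) (zero ∷ cs) iC lc (s≤s le) (_ ∷ bd) with split-by-counts C cs (Linked.tail iC) (Linked.tail lc) le bd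
  ... | ys , vs , il , counts , len =
    c ∷ ys , vs , l∷ c il ,
    cong₂ _∷_ (countIf-none (All.map (λ lt → <ᵇ-false (<⇒≤ lt)) (interleave-Allʳ il (inc-head iC)))) counts , len
  split-by-counts (c ∷ C) []           iC lc le bd = split-as-v c C [] iC lc [] z≤n bd
  split-by-counts (c ∷ C) (suc x ∷ cs) iC lc le (b ∷ bd) =
    split-as-v c C (suc x ∷ cs) iC lc (s≤s z≤n ∷ All.map (λ h → ≤-trans (s≤s z≤n) h) (linked-head ≤-trans lc))
      (≤-pred (m∸n>0⇒n<m {suc (length C)} {suc (length cs)} (≤-trans (s≤s z≤n) b))) (b ∷ bd)
    where
    m∸n>0⇒n<m : ∀ {a b} → 1 ≤ a ∸ b → b < a
    m∸n>0⇒n<m {suc a} {zero}  _ = s≤s z≤n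
    m∸n>0⇒n<m {suc a} {suc b} h = s≤s (m∸n>0⇒n<m h)

  split-as-v : ∀ c C cs → Inc (c ∷ C) → Linked _≤_ cs → All (1 ≤_) cs → length cs ≤ length C →
               All (_≤ suc (length C) ∸ length cs) cs → SplitByCounts (c ∷ C) cs
  split-as-v c C cs iC lc pos le bd with split-by-counts C (map pred cs) (Linked.tail iC) (LinkedP.map⁺ (Linked.map pred-mono-≤ lc))
         (subst (_≤ length C) (sym (length-map pred cs)) le)
         (AllP.map⁺ (All.map (λ {y} h → subst (pred y ≤_) (cong (length C ∸_) (sym (length-map pred cs)))
               (pred-mono-≤ (subst (y ≤_) (+-∸-assoc 1 le) h))) bd))
  ... | ys , vs , il , counts , len =
    ys , c ∷ vs , r∷ c il ,
    trans (map-cong-local (All.map (λ {y} lt → countLess-cons c y vs lt) (interleave-Allˡ il (inc-head iC))))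
      (trans (map-∘ ys) (trans (cong (map suc) counts) (map-suc-pred cs pos))) ,
    trans (cong suc (trans len (cong (length C ∸_) (length-map pred cs)))) (sym (+-∸-assoc 1 le))

takeAbove : ℕ → List ℕ → List ℕ
takeAbove p []       = []
takeAbove p (x ∷ xs) with p <ᵇ x
... | true  = x ∷ takeAbove p xs
... | false = []

dropAbove : ℕ → List ℕ → List ℕ
dropAbove p []       = []
dropAbove p (x ∷ xs) with p <ᵇ x
... | true  = dropAbove p xs
... | false = x ∷ xs

take++drop-above : ∀ p xs → xs ≡ takeAbove p xs ++ dropAbove p xs
take++drop-above p []       = refl
take++drop-above p (x ∷ xs) with p <ᵇ x
... | true  = cong (x ∷_) (take++drop-above p xs)
... | false = refl

takeAbove-above : ∀ p xs → All (p <_) (takeAbove p xs)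
takeAbove-above p []       = []
takeAbove-above p (x ∷ xs) with p <ᵇ x in e
... | true  = <ᵇ-true⁻ p x e ∷ takeAbove-above p xs
... | false = []

dropAbove-atMost : ∀ p xs → Linked (λ a b → b ≤ a) xs → All (_≤ p) (dropAbove p xs)
dropAbove-atMost p []       _ = []
dropAbove-atMost p (x ∷ xs) l with p <ᵇ x in e
... | true  = dropAbove-atMost p xs (Linked.tail l)
... | false = <ᵇ-false⁻ p x e ∷ All.map (λ h → ≤-trans h (<ᵇ-false⁻ p x e)) (linked-head (λ h₁ h₂ → ≤-trans h₂ h₁) l)

strict-above : ∀ {p xs} → Linked (StrictStep p) xs → All (p <_) xs → Linked (λ a b → b < a) xs
strict-above []            _        = []
strict-above [-]           _        = [-]
strict-above ((_ , f) ∷ rs) (pa ∷ ps) = f pa ∷ strict-above rs ps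

not-≡ : ∀ a d → (a ≡ d → ⊥) → not a ≡ d
not-≡ false false ne = ⊥-elim (ne refl)
not-≡ false true  ne = refl
not-≡ true  false ne = refl
not-≡ true  true  ne = ⊥-elim (ne refl)

-- The parts of γ become barred values
-- z = n - (part - (n-k)) when they exceed n-k, plus possibly one part equal to n-k when the
-- tag t requires an odd/even number of bars; the remaining parts are the counts γ-y of
-- the y's, which determine the splitting of the complement into y's and v's.

module Preimage {k n : ℕ} (1≤k : 1 ≤ k) (k<n : k < n) (γ : List ℕ) (t : ℕ) (H : InPtilde k n (γ , t)) where
  p : ℕ
  p = n ∸ k

  k≤n : k ≤ n
  k≤n = <⇒≤ k<n

  1≤n : 1 ≤ n
  1≤n = ≤-trans 1≤k k≤n

  B : ℕ
  B = 2 * n ∸ 1 ∸ k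

  length-γ : length γ ≡ k
  length-γ = proj₁ H

  chain-γ : Linked (StrictStep p) γ
  chain-γ = proj₁ (proj₂ H)

  bounded-γ : All (_≤ B) γ
  bounded-γ = proj₁ (proj₂ (proj₂ H))

  weak-chain : ∀ {xs} → Linked (StrictStep p) xs → Linked (λ a b → b ≤ a) xs
  weak-chain = Linked.map proj₁

  barredType : Bool
  barredType = t ≡ᵇ 2

  record ZSplit : Set where
    field
      zparts yparts : List ℕ
      γ≡        : γ ≡ zparts ++ yparts
      z-strict  : Linked (λ a b → b < a) zparts
      z-above   : All (p ≤_) zparts
      y-atMost  : All (_≤ p) yparts
      y-chain   : Linked (λ a b → b ≤ a) yparts
      parity    : p ∈ γ → odd (length zparts) ≡ barredType

  dropAbove-starts-with-p : p ∈ γ → Σ (List ℕ) (λ r₀ → dropAbove p γ ≡ p ∷ r₀)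
  dropAbove-starts-with-p p∈ with ∈-++⁻ (takeAbove p γ) (subst (p ∈_) (take++drop-above p γ) p∈)
  ... | inj₁ p∈above = ⊥-elim (<-irrefl refl (lookup (takeAbove-above p γ) p∈above))
  ... | inj₂ p∈rest with dropAbove p γ | dropAbove-atMost p γ (weak-chain chain-γ)
                         | linked-++ʳ (takeAbove p γ) (subst (Linked (λ a b → b ≤ a)) (take++drop-above p γ) (weak-chain chain-γ))
                         | p∈rest
  ...   | x ∷ r₀ | x≤p ∷ _ | chain | here refl = r₀ , refl
  ...   | x ∷ r₀ | x≤p ∷ _ | chain | there q   =
    r₀ , cong (_∷ r₀) (≤-antisym x≤p (lookup (linked-head (λ h₁ h₂ → ≤-trans h₂ h₁) chain) q))

  above-chain : Linked (StrictStep p) (takeAbove p γ)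
  above-chain = linked-++ˡ (takeAbove p γ) (subst (Linked (StrictStep p)) (take++drop-above p γ) chain-γ)
  above-strict : Linked (λ a b → b < a) (takeAbove p γ)
  above-strict = strict-above above-chain (takeAbove-above p γ)
  rest-chain : Linked (λ a b → b ≤ a) (dropAbove p γ)
  rest-chain = linked-++ʳ (takeAbove p γ) (subst (Linked (λ a b → b ≤ a)) (take++drop-above p γ) (weak-chain chain-γ))
  aboveOnly : (p ∈ γ → odd (length (takeAbove p γ)) ≡ barredType) → ZSplit
  aboveOnly par = record
    { zparts = takeAbove p γ ; yparts = dropAbove p γ ; γ≡ = take++drop-above p γ
    ; z-strict = above-strict ; z-above = All.map <⇒≤ (takeAbove-above p γ)
    ; y-atMost = dropAbove-atMost p γ (weak-chain chain-γ) ; y-chain = rest-chain ; parity = par }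

  zsplit : ZSplit
  zsplit with proj₂ (proj₂ (proj₂ H))
  ... | inj₁ (p∉γ , _) = aboveOnly (λ p∈ → ⊥-elim (p∉γ p∈))
  ... | inj₂ (p∈γ , _) with odd (length (takeAbove p γ)) Data.Bool.≟ barredType
  ...   | yes e  = aboveOnly (λ _ → e)
  ...   | no ne with dropAbove-starts-with-p p∈γ
  ...     | r₀ , drop≡ = record
    { zparts   = takeAbove p γ ++ p ∷ []
    ; yparts   = r₀
    ; γ≡       = trans (take++drop-above p γ) (trans (cong (takeAbove p γ ++_) drop≡) (sym (++-assoc (takeAbove p γ) (p ∷ []) r₀)))
    ; z-strict = linked-++ {P = p <_} {Q = _≡ p} above-strict [-] (takeAbove-above p γ) (refl ∷ []) (λ { h refl → h })
    ; z-above  = AllP.++⁺ (All.map <⇒≤ (takeAbove-above p γ)) (≤-refl ∷ [])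
    ; y-atMost = All.tail (subst (All (_≤ p)) drop≡ (dropAbove-atMost p γ (weak-chain chain-γ)))
    ; y-chain  = Linked.tail (subst (Linked (λ a b → b ≤ a)) drop≡ rest-chain)
    ; parity   = λ _ → trans (cong odd (trans (length-++ (takeAbove p γ)) (+-comm (length (takeAbove p γ)) 1)))
                              (not-≡ _ barredType ne)
    }

  open ZSplit zsplit

  r′ : ℕ
  r′ = length zparts

  bounded-z : All (_≤ B) zparts
  bounded-z = AllP.++⁻ˡ zparts (subst (All (_≤ B)) γ≡ bounded-γ)

  value-of : ℕ → ℕ
  value-of q = n ∸ (q ∸ p)

  excess≤n-1 : ∀ {q} → q ≤ B → q ∸ p ≤ n ∸ 1
  excess≤n-1 {q} qb = subst (q ∸ p ≤_) (m+n∸m≡n p (n ∸ 1)) (∸-monoˡ-≤ p (subst (q ≤_) (sym (bound-split n k 1≤n k≤n)) qb))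

  in-range : ℕ → Set
  in-range q = p ≤ q × q ≤ B

  zparts-in-range : All in-range zparts
  zparts-in-range = All.zipWith (λ x → x) (z-above , bounded-z)

  γ-z-value-of : ∀ {q} → in-range q → p + (n ∸ value-of q) ≡ q
  γ-z-value-of {q} (pq , qb) = trans (cong (p +_) (m∸[m∸n]≡n (≤-trans (excess≤n-1 qb) (m∸n≤m n 1)))) (m+[n∸m]≡n pq)

  zs : List ℕ
  zs = map value-of zparts

  inc-zs : Inc zs
  inc-zs = linked-map value-of zparts-in-range
    (λ {a} {b} (pa , ba) (pb , bb) b<a → ∸-monoʳ-< (∸-monoˡ-< b<a pb) (≤-trans (excess≤n-1 ba) (m∸n≤m n 1))) z-strict

  zs⊆[1,n] : All (_∈ range 1 n) zs
  zs⊆[1,n] = AllP.map⁺ (All.map (λ {q} (pq , qb) →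
    ∈-range⁺ 1 n (m<n⇒0<n∸m (≤-<-trans (excess≤n-1 qb) (subst (n ∸ 1 <_) (m+[n∸m]≡n 1≤n) ≤-refl)))
                 (s≤s (m∸n≤m n (q ∸ p)))) zparts-in-range)

  complement-z : Σ (List ℕ) (λ C → Interleave zs C (range 1 n))
  complement-z = complement zs (range 1 n) inc-zs (range-inc 1 n) zs⊆[1,n]

  C : List ℕ
  C = proj₁ complement-z

  ilz : Interleave zs C (range 1 n)
  ilz = proj₂ complement-z

  inc-C : Inc C
  inc-C = interleave-incʳ ilz (range-inc 1 n)

  length-C : length C ≡ n ∸ r′
  length-C = sym (trans (cong (_∸ r′) (trans (sym (length-range 1 n))
                   (trans (interleave-length ilz) (cong (_+ length C) (length-map value-of zparts)))))
                   (m+n∸m≡n r′ (length C)))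

  r′+|yparts| : r′ + length yparts ≡ k
  r′+|yparts| = trans (sym (length-++ zparts)) (trans (cong length (sym γ≡)) length-γ)

  r′≤k : r′ ≤ k
  r′≤k = subst (r′ ≤_) r′+|yparts| (m≤m+n r′ _)

  -- The counts of the y's, in increasing order of the y's.
  counts : List ℕ
  counts = reverse yparts

  length-counts : length counts ≡ k ∸ r′
  length-counts = trans (length-reverse yparts) (sym (trans (cong (_∸ r′) (sym r′+|yparts|)) (m+n∸m≡n r′ _)))

  C-room : length C ∸ length counts ≡ p
  C-room = trans (cong₂ _∸_ length-C length-counts) (trans (∸-+-assoc n r′ (k ∸ r′)) (cong (n ∸_) (m+[n∸m]≡n r′≤k)))

  split-C : SplitByCounts C counts
  split-C = split-by-counts C counts inc-C (linked-reverse (λ h₁ h₂ → ≤-trans h₂ h₁) y-chain)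
    (subst₂ _≤_ (sym length-counts) (sym length-C) (∸-monoˡ-≤ r′ k≤n))
    (All.tabulate (λ {x} m → subst (x ≤_) (sym C-room) (lookup y-atMost (AnyP.reverse⁻ m))))

  ys vs : List ℕ
  ys = proj₁ split-C
  vs = proj₁ (proj₂ split-C)

  ily : Interleave ys vs C
  ily = proj₁ (proj₂ (proj₂ split-C))

  counts-ys : map (λ y → countLess y vs) ys ≡ counts
  counts-ys = proj₁ (proj₂ (proj₂ (proj₂ split-C)))

  preimage : WOG k n
  preimage = record
    { r = r′ ; r≤k = r′≤k ; ys = ys ; zs = zs ; vs = vs
    ; len-ys = trans (sym (length-map (λ y → countLess y vs) ys)) (trans (cong length counts-ys) length-counts)
    ; len-zs = length-map value-of zparts
    ; len-vs = trans (proj₂ (proj₂ (proj₂ (proj₂ split-C)))) C-room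
    ; inc-ys = interleave-incˡ ily inc-C ; inc-zs = inc-zs ; inc-vs = interleave-incʳ ily inc-C
    ; perm = ↭-trans (shifts ys zs) (↭-trans (++⁺ˡ zs (interleave-↭ ily))
               (↭-trans (interleave-↭ ilz) (↭-reflexive (sym (between-range 1 n)))))
    }

  γ-preimage : proj₁ (gammaTilde preimage) ≡ γ
  γ-preimage = begin
    map (λ z → p + (n ∸ z)) (map value-of zparts) ++ map (λ y → countLess y vs) (reverse ys)
      ≡⟨ cong₂ _++_ (trans (sym (map-∘ zparts)) (trans (map-cong-local (All.map γ-z-value-of zparts-in-range)) (map-id zparts)))
                    (trans (reverse-map (λ y → countLess y vs) ys) (trans (cong reverse counts-ys) (reverse-involutive yparts))) ⟩
    zparts ++ yparts ≡⟨ sym γ≡ ⟩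
    γ ∎
    where open ≡-Reasoning

  -- The tag of the preimage: by the parity choice, its type matches t.
  tag-preimage : proj₂ (gammaTilde preimage) ≡ t
  tag-preimage = trans (cong tag γ-preimage) (tag-matches (proj₂ (proj₂ (proj₂ H))))
    where
    tag : List ℕ → ℕ
    tag L = if any (_≡ᵇ p) L then (if not (odd r′) then 1 else 2) else 0
    tag-matches : (¬ (p ∈ γ) × t ≡ 0) ⊎ (p ∈ γ × (t ≡ 1 ⊎ t ≡ 2)) → tag γ ≡ t
    tag-matches (inj₁ (p∉γ , t≡0)) with any (_≡ᵇ p) γ in has-p
    ... | false = sym t≡0
    ... | true  = ⊥-elim (p∉γ (any-≡ᵇ⁻ p γ has-p))
    tag-matches (inj₂ (p∈γ , t12)) rewrite any-≡ᵇ⁺ p γ p∈γ | parity p∈γ = by-cases t t12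
      where
      by-cases : ∀ t → t ≡ 1 ⊎ t ≡ 2 → (if not (t ≡ᵇ 2) then 1 else 2) ≡ t
      by-cases .1 (inj₁ refl) = refl
      by-cases .2 (inj₂ refl) = refl

  gammaTilde-preimage : gammaTilde preimage ≡ (γ , t)
  gammaTilde-preimage = cong₂ _,_ γ-preimage tag-preimage

proposition1p11 : (k n : ℕ) → 1 ≤ k → k < n →
    ((w : WOG k n) → InPtilde k n (Fk k n (lam n (toPerm w))))
    × ((w w′ : WOG k n) → Fk k n (lam n (toPerm w)) ≡ Fk k n (lam n (toPerm w′))
         → lam n (toPerm w) ≈ₛ lam n (toPerm w′))
    × ((p : PartT) → InPtilde k n p → Σ (WOG k n) (λ w → Fk k n (lam n (toPerm w)) ≡ p))
    × ((w : WOG k n) → Fk k n (lam n (toPerm w)) ≡ gammaTilde w)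
proposition1p11 k n 1≤k k<n = in-Ptilde , injective , surjective , Fk≡γ̃
  where
  Fk≡γ̃ : (w : WOG k n) → Fk k n (lam n (toPerm w)) ≡ gammaTilde w
  Fk≡γ̃ w = OfW.Fk-lam≡gammaTilde 1≤k k<n w

  in-Ptilde : (w : WOG k n) → InPtilde k n (Fk k n (lam n (toPerm w)))
  in-Ptilde w = subst (InPtilde k n) (sym (Fk≡γ̃ w)) (OfW.gammaTilde∈Ptilde 1≤k k<n w)

  injective : (w w′ : WOG k n) → Fk k n (lam n (toPerm w)) ≡ Fk k n (lam n (toPerm w′)) → lam n (toPerm w) ≈ₛ lam n (toPerm w′)
  injective w w′ e α =
    cong (λ P → lam n P α) (gammaTilde-injective 1≤k k<n w w′ (trans (sym (Fk≡γ̃ w)) (trans e (Fk≡γ̃ w′))))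

  surjective : (p : PartT) → InPtilde k n p → Σ (WOG k n) (λ w → Fk k n (lam n (toPerm w)) ≡ p)
  surjective (γ , t) H = preimage , trans (Fk≡γ̃ preimage) gammaTilde-preimage
    where open Preimage 1≤k k<n γ t H using (preimage; gammaTilde-preimage)
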